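{- Let $a,b\ge0$ and let $T$ be a tableau of shape $(b)^a$. Let $W$ be a tableau containing $T$ in its upper-left corner, such that every entry of $T$ is smaller than every other entry of $W$. If $W=Q\cdot T\cdot P$ is a simple factorization of $W$ with respect to $(b)^a$ and $W=X\cdot T\cdot Y$ is any factorization, then $(X,Y)\to(Q,P)$.
   Context: Tableaux are semistandard Young tableaux with integer entries; $T\cdot U$ is the tableau product (row insertion of the row reading word of $U$, read bottom row to top row, into $T$). Horizontal cut of a tableau $Y$ after row $a$: $Y=\tilde Y\cdot Y_0$ with $Y_0$ the top $a$ rows and $\tilde Y$ the remaining rows. Vertical cut of $X$ after column $b$: $X=X_0\cdot\tilde X$ with $X_0$ the first $b$ columns and $\tilde X$ the remaining columns. $W$ contains $T$ in its upper-left corner if the shape of $W$ contains $(b)^a$ and the entries of $W$ there form $T$. Let $Q_0$, $P_0$, $Z$ be the parts of $W$ in (rows $>a$, columns $\le b$), (rows $\le a$, columns $>b$), (rows $>a$, columns $>b$), each a straight-shape tableau. A simple factorization of $W$ w.r.t. $(b)^a$ is a factorization $W=Q\cdot T\cdot P$ with $Q=Q_0\cdot\tilde Q$, $P=\tilde P\cdot P_0$ for some factorization $Z=\tilde Q\cdot\tilde P$. Relation: for pairs $(X,Y)$ of tableaux all of whose entries are strictly larger than all entries of $T$, with cuts $X=X_0\cdot\tilde X$ (vertical, after column $b$) and $Y=\tilde Y\cdot Y_0$ (horizontal, after row $a$), write $(X,Y)\models(X',Y')$ if either (1) $\tilde X=M\cdot N$ for some tableaux $M,N$ with $X'=X_0\cdot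 M$ and $Y'=N\cdot Y$, or (2) $\tilde Y=M\cdot N$ for some tableaux $M,N$ with $X'=X\cdot M$ and $Y'=N\cdot Y_0$. The relation $\to$ is the transitive closure of $\models$ (it depends on $T,a,b$). -}

module Defs where

open import Data.Nat as ℕ using (ℕ; zero; suc)
open import Data.Integer as ℤ using (ℤ)
open import Data.List using (List; []; _∷_; [_]; concat; reverse; take; drop; map; length; replicate; foldl)
open import Data.List.Relation.Unary.All using (All)
open import Data.List.Relation.Unary.Linked using (Linked)
open import Data.List.Membership.Propositional using (_∈_)
open import Data.Maybe using (Maybe; just; nothing)
open import Data.Product using (_×_; _,_; ∃-syntax)
open import Relation.Nullary using (yes; no; ¬_)
open import Relation.Binary.PropositionalEquality using (_≡_)
open import Relation.Binary.Construct.Closure.Transitive using (TransClosure)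

-- A tableau is represented by its list of rows, top row first,
-- each row read left to right.  Rows are nonempty.
Tab : Set
Tab = List (List ℤ)

data ColStrict : List ℤ → List ℤ → Set where
  []  : ∀ {xs} → ColStrict xs []
  _∷_ : ∀ {x y xs ys} → x ℤ.< y → ColStrict xs ys → ColStrict (x ∷ xs) (y ∷ ys)

data NonEmpty : List ℤ → Set where
  nonEmpty : ∀ {x xs} → NonEmpty (x ∷ xs)

IsTableau : Tab → Set
IsTableau T = All NonEmpty T × All (Linked ℤ._≤_) T × Linked ColStrict T

shape : Tab → List ℕ
shape = map length

-- the rectangular shape (b)^a (empty partition when a = 0 or b = 0)
rect : ℕ → ℕ → List ℕ
rect a zero = []
rect a (suc b) = replicate a (suc b)

rowIns : ℤ → List ℤ → List ℤ × Maybe ℤ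
rowIns x [] = (x ∷ [] , nothing)
rowIns x (y ∷ ys) with x ℤ.<? y
... | yes _ = (x ∷ ys , just y)
... | no _ with rowIns x ys
...   | (r , m) = (y ∷ r , m)

ins : ℤ → Tab → Tab
ins x [] = (x ∷ []) ∷ []
ins x (r ∷ rs) with rowIns x r
... | (r' , nothing) = r' ∷ rs
... | (r' , just y) = r' ∷ ins y rs

readingWord : Tab → List ℤ
readingWord U = concat (reverse U)

insWord : Tab → List ℤ → Tab
insWord = foldl (λ T x → ins x T)

infixl 6 _·_
_·_ : Tab → Tab → Tab
T · U = insWord T (readingWord U)

removeEmpty : Tab → Tab
removeEmpty [] = []
removeEmpty ([] ∷ rs) = removeEmpty rs
removeEmpty ((x ∷ xs) ∷ rs) = (x ∷ xs) ∷ removeEmpty rs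

-- vertical cut after column b : X = colsLeft b X · colsRight b X
colsLeft : ℕ → Tab → Tab
colsLeft b X = removeEmpty (map (take b) X)

colsRight : ℕ → Tab → Tab
colsRight b X = removeEmpty (map (drop b) X)

-- horizontal cut after row a : Y = rowsBottom a Y · rowsTop a Y
rowsTop : ℕ → Tab → Tab
rowsTop a Y = take a Y

rowsBottom : ℕ → Tab → Tab
rowsBottom a Y = drop a Y

-- length of row i (0-based), 0 if absent
rowLen : Tab → ℕ → ℕ
rowLen [] i = 0
rowLen (r ∷ rs) zero = length r
rowLen (r ∷ rs) (suc i) = rowLen rs i

ContainsRect : ℕ → ℕ → Tab → Set
ContainsRect a b W = ∀ i → i ℕ.< a → b ℕ.≤ rowLen W i

ContainsCorner : ℕ → ℕ → Tab → Tab → Set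
ContainsCorner a b T W = ContainsRect a b W × colsLeft b (rowsTop a W) ≡ T

Q₀ : ℕ → ℕ → Tab → Tab
Q₀ a b W = colsLeft b (rowsBottom a W)

P₀ : ℕ → ℕ → Tab → Tab
P₀ a b W = colsRight b (rowsTop a W)

Zpart : ℕ → ℕ → Tab → Tab
Zpart a b W = colsRight b (rowsBottom a W)

AllSmaller : Tab → Tab → Set
AllSmaller T U = ∀ {x y} → x ∈ concat T → y ∈ concat U → x ℤ.< y

CornerSmallest : ℕ → ℕ → Tab → Tab → Set
CornerSmallest a b T W =
  AllSmaller T (Q₀ a b W) × AllSmaller T (P₀ a b W) × AllSmaller T (Zpart a b W)

SimpleFactorization : ℕ → ℕ → Tab → Tab → Tab → Tab → Set
SimpleFactorization a b T W Q P =
  IsTableau Q × IsTableau P × W ≡ Q · T · P ×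
  ∃[ Q̃ ] ∃[ P̃ ] (IsTableau Q̃ × IsTableau P̃ × Zpart a b W ≡ Q̃ · P̃ ×
                  Q ≡ Q₀ a b W · Q̃ × P ≡ P̃ · P₀ a b W)

Admissible : Tab → Tab → Tab → Set
Admissible T X Y = IsTableau X × IsTableau Y × AllSmaller T X × AllSmaller T Y

data Step (T : Tab) (a b : ℕ) : Tab × Tab → Tab × Tab → Set where
  step₁ : ∀ {X Y} M N → Admissible T X Y → IsTableau M → IsTableau N →
          colsRight b X ≡ M · N →
          Step T a b (X , Y) (colsLeft b X · M , N · Y)
  step₂ : ∀ {X Y} M N → Admissible T X Y → IsTableau M → IsTableau N →
          rowsBottom a Y ≡ M · N →
          Step T a b (X , Y) (X · M , N · rowsTop a Y)

_⟶[_,_,_]_ : Tab × Tab → Tab → ℕ → ℕ → Tab × Tab → Set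
p ⟶[ T , a , b ] q = TransClosure (Step T a b) p q

{-# OPTIONS --safe #-}
-- Since T holds the smallest entries and is a b-wide rectangle, X · T is T stacked on top of the
-- first b columns X₀ of X, with the remaining columns X̃ of X unmoved beside T.  Inserting Y, whose
-- entries also exceed those of T, never touches T: the top a rows of W are T beside the top a rows
-- of X̃ · Y, and, by associativity of the product (Knuth equivalence), the rows below are
-- X₀ · (X̃ · Y below row a).  Hence (X , Y) ⊨ (X₀ , X̃ · Y) ⊨ (W below row a , P₀) ⊨ (Q , P), the
-- last step splitting Z = Q̃ · P̃.  That X and Y lie above T holds because the product permutes
-- entries, so X and Y together carry exactly the entries of W outside its corner.
module Submission where

open import Defs
open import Data.Nat as ℕ using (ℕ; zero; suc)
open import Data.Integer using (ℤ; _≤_; _<_; _<?_)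
open import Data.Integer.Properties
  using (≤-refl; ≤-trans; <-trans; <⇒≤; <⇒≱; ≮⇒≥; ≤-<-trans; <-≤-trans)
open import Data.List using (List; []; _∷_; [_]; _++_; concat; reverse; length; fromMaybe; take; drop; map; replicate)
open import Data.List.Properties
  using ( foldl-++; ++-assoc; concat-++; ++-identityʳ; unfold-reverse; take++drop≡id; drop-drop; drop-map
        ; take-[]; drop-[]; length-take; ∷-injectiveˡ; ∷-injectiveʳ)
open import Data.List.Relation.Unary.All as All using (All; []; _∷_)
import Data.List.Relation.Unary.All.Properties as AllP
open import Data.Nat.Properties as ℕP using (suc-injective; +-comm)
open import Data.List.Membership.Propositional using (_∈_)
open import Data.List.Membership.Propositional.Properties using (∈-concat⁺′)
open import Data.List.Relation.Unary.Linked as Linked using (Linked; []; [-]; _∷_)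
import Data.List.Relation.Unary.Linked.Properties as LinkedP
open import Data.List.Relation.Binary.Permutation.Propositional
  using (_↭_; ↭-refl; ↭-sym; ↭-trans; ↭-reflexive; prep; swap; module PermutationReasoning)
import Data.List.Relation.Binary.Permutation.Propositional.Properties as ↭
open import Data.Maybe using (just; nothing)
open import Data.Product using (_×_; _,_; proj₁; proj₂; ∃-syntax; map₁)
open import Data.Sum using (_⊎_; inj₁; inj₂)
open import Data.Empty using (⊥; ⊥-elim)
open import Data.Unit using (⊤; tt)
open import Relation.Nullary using (yes; no)
open import Function using (_∘_)
open import Relation.Binary.Construct.Closure.Transitive as TransClosure using (_∷_)
open import Relation.Binary.PropositionalEquality
  using (_≡_; refl; sym; trans; cong; cong₂; subst; module ≡-Reasoning)

Sorted : List ℤ → Set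
Sorted = Linked _≤_

<⊎≥ : ∀ x y → x < y ⊎ y ≤ x
<⊎≥ x y with x <? y
... | yes x<y = inj₁ x<y
... | no x≮y = inj₂ (≮⇒≥ x≮y)

sorted-head≤ : ∀ {x r} → Sorted (x ∷ r) → All (x ≤_) r
sorted-head≤ [-] = []
sorted-head≤ (p ∷ l) = p ∷ All.map (≤-trans p) (sorted-head≤ l)

sorted-∷ : ∀ {h r} → All (h ≤_) r → Sorted r → Sorted (h ∷ r)
sorted-∷ [] _ = [-]
sorted-∷ (p ∷ _) l = p ∷ l

-- Row insertion

rowIns-< : ∀ {x y} ys → x < y → rowIns x (y ∷ ys) ≡ (x ∷ ys , just y)
rowIns-< {x} {y} ys x<y with x <? y
... | yes _ = refl
... | no x≮y = ⊥-elim (x≮y x<y)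

rowIns-≥ : ∀ {x y ys ys′ m} → y ≤ x → rowIns x ys ≡ (ys′ , m) → rowIns x (y ∷ ys) ≡ (y ∷ ys′ , m)
rowIns-≥ {x} {y} {ys} y≤x eq with x <? y
... | yes x<y = ⊥-elim (<⇒≱ x<y y≤x)
... | no _ with rowIns x ys
rowIns-≥ y≤x refl | no _ | _ = refl

rowIns-append : ∀ x R {R′} → rowIns x R ≡ (R′ , nothing) → R′ ≡ R ++ [ x ]
rowIns-append x [] refl = refl
rowIns-append x (h ∷ R) eq with x <? h
rowIns-append x (h ∷ R) () | yes _
... | no _ with rowIns x R in e
...   | (_ , nothing) with eq
...     | refl = cong (h ∷_) (rowIns-append x R e)

bump-> : ∀ x R {R′ d} → rowIns x R ≡ (R′ , just d) → x < d
bump-> x [] ()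
bump-> x (h ∷ R) eq with x <? h
bump-> x (h ∷ R) refl | yes x<h = x<h
... | no _ with rowIns x R in e
...   | (_ , just _) with eq
...     | refl = bump-> x R e

All-bump : ∀ {P : ℤ → Set} x R {R′ d} → All P R → rowIns x R ≡ (R′ , just d) → P d
All-bump x [] _ ()
All-bump x (h ∷ R) (ph ∷ pR) eq with x <? h
All-bump x (h ∷ R) (ph ∷ pR) refl | yes _ = ph
... | no _ with rowIns x R in e
...   | (_ , just _) with eq
...     | refl = All-bump x R pR e

All-rowIns : ∀ {P : ℤ → Set} x R → All P R → P x →
             All P (proj₁ (rowIns x R)) × All P (fromMaybe (proj₂ (rowIns x R)))
All-rowIns x [] _ px = px ∷ [] , []
All-rowIns x (h ∷ R) (ph ∷ pR) px with x <? h
... | yes _ = px ∷ pR , ph ∷ []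
... | no _ = map₁ (ph ∷_) (All-rowIns x R pR px)

sorted-rowIns : ∀ x R → Sorted R → Sorted (proj₁ (rowIns x R))
sorted-rowIns x [] _ = [-]
sorted-rowIns x (h ∷ R) sR with x <? h
... | yes x<h = sorted-∷ (All.map (≤-trans (<⇒≤ x<h)) (sorted-head≤ sR)) (Linked.tail sR)
... | no x≮h = sorted-∷ (proj₁ (All-rowIns x R (sorted-head≤ sR) (≮⇒≥ x≮h))) (sorted-rowIns x R (Linked.tail sR))

rowIns-nonEmpty : ∀ x R → NonEmpty (proj₁ (rowIns x R))
rowIns-nonEmpty x [] = nonEmpty
rowIns-nonEmpty x (h ∷ R) with x <? h
... | yes _ = nonEmpty
... | no _ = nonEmpty

bump-after-larger : ∀ {y z} → y < z → ∀ R →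
                    ∃[ e ] proj₂ (rowIns y (proj₁ (rowIns z R))) ≡ just e × e ≤ z
bump-after-larger {y} {z} y<z [] with y <? z
... | yes _ = z , refl , ≤-refl
... | no y≮z = ⊥-elim (y≮z y<z)
bump-after-larger {y} {z} y<z (h ∷ R) with z <? h
... | yes z<h with y <? z
...   | yes _ = z , refl , ≤-refl
...   | no y≮z = ⊥-elim (y≮z y<z)
bump-after-larger {y} {z} y<z (h ∷ R) | no z≮h with y <? h
...   | yes _ = h , refl , ≮⇒≥ z≮h
...   | no _ = bump-after-larger y<z R

noBump-mono : ∀ {y z} R {R′} → rowIns y R ≡ (R′ , nothing) → y ≤ z → proj₂ (rowIns z R′) ≡ nothing
noBump-mono {y} {z} [] refl y≤z with z <? y
... | yes z<y = ⊥-elim (<⇒≱ z<y y≤z)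
... | no _ = refl
noBump-mono {y} {z} (h ∷ R) eq y≤z with y <? h
noBump-mono (h ∷ R) () y≤z | yes _
... | no y≮h with rowIns y R in e
...   | (_ , nothing) with eq
...     | refl with z <? h
...       | yes z<h = ⊥-elim (<⇒≱ z<h (≤-trans (≮⇒≥ y≮h) y≤z))
...       | no _ = noBump-mono R e y≤z

bump-mono : ∀ {y z} R {R₁ R₂ d e} → Sorted R → rowIns y R ≡ (R₁ , just d) → y ≤ z →
            rowIns z R₁ ≡ (R₂ , just e) → d ≤ e
bump-mono [] _ () _ _
bump-mono {y} {z} (h ∷ R) sR ey y≤z ez with y <? h
bump-mono {y} {z} (h ∷ R) sR refl y≤z ez | yes _ with z <? y
... | yes z<y = ⊥-elim (<⇒≱ z<y y≤z)
... | no _ with rowIns z R in e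
...   | (_ , just _) with ez
...     | refl = All-bump z R (sorted-head≤ sR) e
bump-mono {y} {z} (h ∷ R) sR ey y≤z ez | no y≮h with rowIns y R in e₁
... | (R₁ , just _) with ey
...   | refl with z <? h
...     | yes z<h = ⊥-elim (<⇒≱ z<h (≤-trans (≮⇒≥ y≮h) y≤z))
...     | no _ with rowIns z R₁ in e₂
...       | (_ , just _) with ez
...         | refl = bump-mono R (Linked.tail sR) e₁ y≤z e₂

bumpedRow-head : ∀ {c x y} R {R′} → c ≤ x → All (c ≤_) R → rowIns x R ≡ (R′ , just y) →
                 ∃[ e ] ∃[ R″ ] R′ ≡ e ∷ R″ × c ≤ e × e < y
bumpedRow-head [] _ _ ()
bumpedRow-head {x = x} (h ∷ R) c≤x (c≤h ∷ cR) eq with x <? h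
bumpedRow-head {x = x} (h ∷ R) c≤x (c≤h ∷ cR) refl | yes x<h = x , R , refl , c≤x , x<h
... | no x≮h with rowIns x R in e
...   | (_ , just _) with eq
...     | refl = h , _ , refl , c≤h , ≤-<-trans (≮⇒≥ x≮h) (bump-> x R e)

rowInsWord : List ℤ → List ℤ → List ℤ × List ℤ
rowInsWord R [] = (R , [])
rowInsWord R (x ∷ w) =
  (proj₁ (rowInsWord (proj₁ (rowIns x R)) w) ,
   fromMaybe (proj₂ (rowIns x R)) ++ proj₂ (rowInsWord (proj₁ (rowIns x R)) w))

insWord-∷ : ∀ R S w → insWord (R ∷ S) w ≡ proj₁ (rowInsWord R w) ∷ insWord S (proj₂ (rowInsWord R w))
insWord-∷ R S [] = refl
insWord-∷ R S (x ∷ w) with rowIns x R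
... | (R′ , nothing) = insWord-∷ R′ S w
... | (R′ , just y) = insWord-∷ R′ (ins y S) w

insWord-∷-≡ : ∀ R S w {R′ β} → rowInsWord R w ≡ (R′ , β) → insWord (R ∷ S) w ≡ R′ ∷ insWord S β
insWord-∷-≡ R S w eq = trans (insWord-∷ R S w) (cong (λ p → proj₁ p ∷ insWord S (proj₂ p)) eq)

insWord-++ : ∀ S u v → insWord S (u ++ v) ≡ insWord (insWord S u) v
insWord-++ = foldl-++ (λ T x → ins x T)

rowsInsWord : Tab → List ℤ → Tab × List ℤ
rowsInsWord [] w = ([] , w)
rowsInsWord (R ∷ Rs) w =
  (proj₁ (rowInsWord R w) ∷ proj₁ (rowsInsWord Rs (proj₂ (rowInsWord R w))) ,
   proj₂ (rowsInsWord Rs (proj₂ (rowInsWord R w))))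

insWord-rows-++ : ∀ Rs S w →
                  insWord (Rs ++ S) w ≡ proj₁ (rowsInsWord Rs w) ++ insWord S (proj₂ (rowsInsWord Rs w))
insWord-rows-++ [] S w = refl
insWord-rows-++ (R ∷ Rs) S w =
  trans (insWord-∷ R (Rs ++ S) w) (cong (proj₁ (rowInsWord R w) ∷_) (insWord-rows-++ Rs S _))

length-rowsInsWord : ∀ Rs w → length (proj₁ (rowsInsWord Rs w)) ≡ length Rs
length-rowsInsWord [] w = refl
length-rowsInsWord (R ∷ Rs) w = cong suc (length-rowsInsWord Rs _)

readingWord-∷ : ∀ u Us → readingWord (u ∷ Us) ≡ readingWord Us ++ u
readingWord-∷ u Us = begin
  concat (reverse (u ∷ Us))      ≡⟨ cong concat (unfold-reverse u Us) ⟩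
  concat (reverse Us ++ [ u ])   ≡⟨ sym (concat-++ (reverse Us) [ u ]) ⟩
  concat (reverse Us) ++ u ++ [] ≡⟨ cong (concat (reverse Us) ++_) (++-identityʳ u) ⟩
  concat (reverse Us) ++ u       ∎
  where open ≡-Reasoning

rowInsWord-step : ∀ x R w {R₁ m} → rowIns x R ≡ (R₁ , m) →
                  rowInsWord R (x ∷ w) ≡ (proj₁ (rowInsWord R₁ w) , fromMaybe m ++ proj₂ (rowInsWord R₁ w))
rowInsWord-step x R w eq rewrite eq = refl

rowIns-skip : ∀ p R x → All (_≤ x) p → rowIns x (p ++ R) ≡ (p ++ proj₁ (rowIns x R) , proj₂ (rowIns x R))
rowIns-skip [] R x _ = refl
rowIns-skip (e ∷ p) R x (e≤x ∷ p≤x) = rowIns-≥ e≤x (rowIns-skip p R x p≤x)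

rowInsWord-skip : ∀ p R w → All (λ x → All (_≤ x) p) w →
                  rowInsWord (p ++ R) w ≡ (p ++ proj₁ (rowInsWord R w) , proj₂ (rowInsWord R w))
rowInsWord-skip p R [] _ = refl
rowInsWord-skip p R (x ∷ w) (p≤x ∷ p≤w)
  rewrite rowIns-skip p R x p≤x | rowInsWord-skip p (proj₁ (rowIns x R)) w p≤w = refl

bounded-snoc : ∀ {p x r} → All (λ e → All (e ≤_) (x ∷ r)) p → Sorted (x ∷ r) → All (λ e → All (e ≤_) r) (p ++ [ x ])
bounded-snoc p≤r sr = AllP.++⁺ (All.map All.tail p≤r) (sorted-head≤ sr ∷ [])

-- When s is shorter than r, the last letters of r are appended, so nothing may follow s.
rowInsWord-replace : ∀ p r s q → All (λ e → All (e ≤_) r) p → Sorted r → ColStrict r s →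
                     length s ≡ length r ⊎ q ≡ [] → rowInsWord (p ++ s ++ q) r ≡ (p ++ r ++ q , s)
rowInsWord-replace p [] [] q _ _ [] _ = refl
rowInsWord-replace p (x ∷ r) [] q p≤r sr [] (inj₁ ())
rowInsWord-replace p (x ∷ r) [] .[] p≤r sr [] (inj₂ refl) = begin
  rowInsWord (p ++ []) (x ∷ r)            ≡⟨ rowInsWord-step x (p ++ []) r x-appends ⟩
  rowInsWord ((p ++ [ x ]) ++ []) r
    ≡⟨ rowInsWord-replace (p ++ [ x ]) r [] [] (bounded-snoc p≤r sr) (Linked.tail sr) [] (inj₂ refl) ⟩
  ((p ++ [ x ]) ++ r ++ [] , [])          ≡⟨ cong (_, []) (++-assoc p [ x ] (r ++ [])) ⟩
  (p ++ x ∷ r ++ [] , [])                 ∎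
  where
  open ≡-Reasoning
  x-appends : rowIns x (p ++ []) ≡ ((p ++ [ x ]) ++ [] , nothing)
  x-appends = trans (rowIns-skip p [] x (All.map All.head p≤r)) (cong (_, nothing) (sym (++-identityʳ (p ++ [ x ]))))
rowInsWord-replace p (x ∷ r) (y ∷ s) q p≤r sr (x<y ∷ rs) len = begin
  rowInsWord (p ++ y ∷ s ++ q) (x ∷ r)
    ≡⟨ rowInsWord-step x (p ++ y ∷ s ++ q) r x-bumps-y ⟩
  (proj₁ (rowInsWord ((p ++ [ x ]) ++ s ++ q) r) , y ∷ proj₂ (rowInsWord ((p ++ [ x ]) ++ s ++ q) r))
    ≡⟨ cong (λ z → proj₁ z , y ∷ proj₂ z)
            (rowInsWord-replace (p ++ [ x ]) r s q (bounded-snoc p≤r sr) (Linked.tail sr) rs (shorten len)) ⟩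
  ((p ++ [ x ]) ++ r ++ q , y ∷ s)
    ≡⟨ cong (_, y ∷ s) (++-assoc p [ x ] (r ++ q)) ⟩
  (p ++ x ∷ r ++ q , y ∷ s) ∎
  where
  open ≡-Reasoning
  x-bumps-y : rowIns x (p ++ y ∷ s ++ q) ≡ ((p ++ [ x ]) ++ s ++ q , just y)
  x-bumps-y = trans (rowIns-skip p (y ∷ s ++ q) x (All.map All.head p≤r))
             (trans (cong (λ z → p ++ proj₁ z , proj₂ z) (rowIns-< (s ++ q) x<y))
                    (cong (_, just y) (sym (++-assoc p [ x ] (s ++ q)))))
  shorten : length (y ∷ s) ≡ length (x ∷ r) ⊎ q ≡ [] → length s ≡ length r ⊎ q ≡ []
  shorten (inj₁ e) = inj₁ (suc-injective e)
  shorten (inj₂ e) = inj₂ e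

headRow : Tab → List ℤ
headRow [] = []
headRow (R ∷ _) = R

ColStrict-snoc : ∀ {R S} x → ColStrict R S → ColStrict (R ++ [ x ]) S
ColStrict-snoc x [] = []
ColStrict-snoc x (p ∷ c) = p ∷ ColStrict-snoc x c

ColStrict-bumpedRow : ∀ x R S {R′ y} → ColStrict R S → rowIns x R ≡ (R′ , just y) → ColStrict R′ S
ColStrict-bumpedRow x [] S _ ()
ColStrict-bumpedRow x (c ∷ R) S cs eq with x <? c
ColStrict-bumpedRow x (c ∷ R) [] cs refl | yes _ = []
ColStrict-bumpedRow x (c ∷ R) (s ∷ S) (c<s ∷ cs) refl | yes x<c = <-trans x<c c<s ∷ cs
... | no _ with rowIns x R in e
...   | (_ , just _) with eq
ColStrict-bumpedRow x (c ∷ R) [] cs eq | no _ | _ | refl = []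
ColStrict-bumpedRow x (c ∷ R) (s ∷ S) (c<s ∷ cs) eq | no _ | _ | refl = c<s ∷ ColStrict-bumpedRow x R S cs e

rowIns-head<bump : ∀ x R {R′ y} → rowIns x R ≡ (R′ , just y) → ColStrict R′ [ y ]
rowIns-head<bump x [] ()
rowIns-head<bump x (c ∷ R) eq with x <? c
rowIns-head<bump x (c ∷ R) refl | yes x<c = x<c ∷ []
... | no x≮c with rowIns x R in e
...   | (_ , just _) with eq
...     | refl = ≤-<-trans (≮⇒≥ x≮c) (bump-> x R e) ∷ []

ColStrict-rowIns : ∀ x R S {R′ y} → ColStrict R S → rowIns x R ≡ (R′ , just y) →
                   ColStrict R′ (proj₁ (rowIns y S))
ColStrict-rowIns x R [] cs eq = rowIns-head<bump x R eq
ColStrict-rowIns x [] (s ∷ S) () eq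
ColStrict-rowIns x (c ∷ R) (s ∷ S) (c<s ∷ cs) eq with x <? c
ColStrict-rowIns x (c ∷ R) (s ∷ S) (c<s ∷ cs) refl | yes x<c rewrite rowIns-< S c<s = x<c ∷ cs
... | no x≮c with rowIns x R in e
...   | (_ , just y) with eq
...     | refl with <⊎≥ y s
...       | inj₁ y<s rewrite rowIns-< S y<s =
  ≤-<-trans (≮⇒≥ x≮c) (bump-> x R e) ∷ ColStrict-bumpedRow x R S cs e
...       | inj₂ s≤y rewrite rowIns-≥ {ys = S} s≤y refl = c<s ∷ ColStrict-rowIns x R S cs e

ins-head : ∀ y S → ∃[ S′ ] ins y S ≡ proj₁ (rowIns y (headRow S)) ∷ S′
ins-head y [] = [] , refl
ins-head y (R ∷ S) with rowIns y R
... | (_ , nothing) = S , refl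
... | (_ , just z) = ins z S , refl

ins-colStrict : ∀ x S → Linked ColStrict S → Linked ColStrict (ins x S)
ins-colStrict x [] _ = [-]
ins-colStrict x (R ∷ S) cS with rowIns x R in eq
ins-colStrict x (R ∷ []) cS | (_ , nothing) = [-]
ins-colStrict x (R ∷ R₂ ∷ S) (c ∷ cS) | (_ , nothing) rewrite rowIns-append x R eq = ColStrict-snoc x c ∷ cS
ins-colStrict x (R ∷ S) cS | (_ , just y) with ins-head y S | ins-colStrict y S (Linked.tail cS)
... | (S′ , e) | ih rewrite e = ColStrict-rowIns x R (headRow S) (above S cS) eq ∷ ih
  where
  above : ∀ S → Linked ColStrict (R ∷ S) → ColStrict R (headRow S)
  above [] _ = []
  above (_ ∷ _) (c ∷ _) = c

ins-sorted : ∀ x S → All Sorted S → All Sorted (ins x S)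
ins-sorted x [] _ = [-] ∷ []
ins-sorted x (R ∷ S) (sR ∷ sS) with rowIns x R in eq
... | (_ , nothing) = subst Sorted (cong proj₁ eq) (sorted-rowIns x R sR) ∷ sS
... | (_ , just y) = subst Sorted (cong proj₁ eq) (sorted-rowIns x R sR) ∷ ins-sorted y S sS

insWord-sorted : ∀ S w → All Sorted S → All Sorted (insWord S w)
insWord-sorted S [] sS = sS
insWord-sorted S (x ∷ w) sS = insWord-sorted (ins x S) w (ins-sorted x S sS)

ins-nonEmpty : ∀ x S → All NonEmpty S → All NonEmpty (ins x S)
ins-nonEmpty x [] _ = nonEmpty ∷ []
ins-nonEmpty x (R ∷ S) (_ ∷ nS) with rowIns x R in eq
... | (_ , nothing) = subst NonEmpty (cong proj₁ eq) (rowIns-nonEmpty x R) ∷ nS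
... | (_ , just y) = subst NonEmpty (cong proj₁ eq) (rowIns-nonEmpty x R) ∷ ins-nonEmpty y S nS

ins-IsTableau : ∀ x S → IsTableau S → IsTableau (ins x S)
ins-IsTableau x S (nS , sS , cS) = ins-nonEmpty x S nS , ins-sorted x S sS , ins-colStrict x S cS

insWord-IsTableau : ∀ S w → IsTableau S → IsTableau (insWord S w)
insWord-IsTableau S [] t = t
insWord-IsTableau S (x ∷ w) t = insWord-IsTableau (ins x S) w (ins-IsTableau x S t)

-- Knuth relations and associativity of the product

infix 4 _⇄_ _⇄⁼_ _≈ᴷ_

data _⇄_ : List ℤ → List ℤ → Set where
  xzy⇄zxy : ∀ {x y z} → x ≤ y → y < z → x ∷ z ∷ y ∷ [] ⇄ z ∷ x ∷ y ∷ []
  yxz⇄yzx : ∀ {x y z} → x < y → y ≤ z → y ∷ x ∷ z ∷ [] ⇄ y ∷ z ∷ x ∷ []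

_⇄⁼_ : List ℤ → List ℤ → Set
u ⇄⁼ v = u ≡ v ⊎ u ⇄ v ⊎ v ⇄ u

InsertAlike : List ℤ → List ℤ → List ℤ → Set
InsertAlike R u v =
  proj₁ (rowInsWord R u) ≡ proj₁ (rowInsWord R v) × proj₂ (rowInsWord R u) ⇄⁼ proj₂ (rowInsWord R v)

insertAlike : ∀ R u v {R′ β γ} → rowInsWord R u ≡ (R′ , β) → rowInsWord R v ≡ (R′ , γ) → β ⇄⁼ γ →
              InsertAlike R u v
insertAlike R u v eu ev β⇄γ rewrite eu | ev = refl , β⇄γ

rowInsWord-three : ∀ x y z R {R₁ m₁ R₂ m₂ R₃ m₃} →
                   rowIns x R ≡ (R₁ , m₁) → rowIns y R₁ ≡ (R₂ , m₂) → rowIns z R₂ ≡ (R₃ , m₃) →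
                   rowInsWord R (x ∷ y ∷ z ∷ []) ≡ (R₃ , fromMaybe m₁ ++ fromMaybe m₂ ++ fromMaybe m₃ ++ [])
rowInsWord-three x y z R e₁ e₂ e₃ rewrite e₁ | e₂ | e₃ = refl

rowInsWord-[]-⇄ : ∀ {u v} → u ⇄ v → rowInsWord [] u ≡ rowInsWord [] v
rowInsWord-[]-⇄ (xzy⇄zxy {x} {y} {z} x≤y y<z) =
  trans (rowInsWord-three x z y [] refl (rowIns-≥ (≤-trans x≤y (<⇒≤ y<z)) refl) (rowIns-≥ x≤y (rowIns-< [] y<z)))
        (sym (rowInsWord-three z x y [] refl (rowIns-< [] (≤-<-trans x≤y y<z)) (rowIns-≥ x≤y refl)))
rowInsWord-[]-⇄ (yxz⇄yzx {x} {y} {z} x<y y≤z) =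
  trans (rowInsWord-three y x z [] refl (rowIns-< [] x<y) (rowIns-≥ (≤-trans (<⇒≤ x<y) y≤z) refl))
        (sym (rowInsWord-three y z x [] refl (rowIns-≥ y≤z refl) (rowIns-< (z ∷ []) x<y)))

insertAlike-skip : ∀ c R u v → All (c ≤_) u → All (c ≤_) v → InsertAlike R u v → InsertAlike (c ∷ R) u v
insertAlike-skip c R u v c≤u c≤v (same , related)
  rewrite rowInsWord-skip [ c ] R u (All.map (_∷ []) c≤u) | rowInsWord-skip [ c ] R v (All.map (_∷ []) c≤v) =
  cong (c ∷_) same , related

xzy⇄zxy-all<c : ∀ c R {x y z} → Sorted (c ∷ R) → x ≤ y → y < z → x < c → z < c →
                InsertAlike (c ∷ R) (x ∷ z ∷ y ∷ []) (z ∷ x ∷ y ∷ [])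
xzy⇄zxy-all<c c [] {x} {y} {z} _ x≤y y<z x<c z<c =
  let x<z = ≤-<-trans x≤y y<z in
  insertAlike (c ∷ []) (x ∷ z ∷ y ∷ []) (z ∷ x ∷ y ∷ [])
    (rowInsWord-three x z y (c ∷ []) (rowIns-< [] x<c) (rowIns-≥ (<⇒≤ x<z) refl) (rowIns-≥ x≤y (rowIns-< [] y<z)))
    (rowInsWord-three z x y (c ∷ []) (rowIns-< [] z<c) (rowIns-< [] x<z) (rowIns-≥ x≤y refl))
    (inj₁ refl)
xzy⇄zxy-all<c c (h ∷ R) {x} {y} {z} (c≤h ∷ _) x≤y y<z x<c z<c =
  let x<z = ≤-<-trans x≤y y<z
      z<h = <-≤-trans z<c c≤h
      y<h = <-trans y<z z<h in
  insertAlike (c ∷ h ∷ R) (x ∷ z ∷ y ∷ []) (z ∷ x ∷ y ∷ [])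
    (rowInsWord-three x z y (c ∷ h ∷ R) (rowIns-< (h ∷ R) x<c) (rowIns-≥ (<⇒≤ x<z) (rowIns-< R z<h))
                      (rowIns-≥ x≤y (rowIns-< R y<z)))
    (rowInsWord-three z x y (c ∷ h ∷ R) (rowIns-< (h ∷ R) z<c) (rowIns-< (h ∷ R) x<z) (rowIns-≥ x≤y (rowIns-< R y<h)))
    (inj₂ (inj₂ (yxz⇄yzx z<c c≤h)))

xzy⇄zxy-x<c≤z : ∀ {c y z R R₁ R₂ mz my} → Sorted (c ∷ R) → c ≤ z → y < z →
                   rowIns z R ≡ (R₁ , mz) → rowIns y R₁ ≡ (R₂ , my) →
                   c ∷ fromMaybe mz ++ fromMaybe my ++ [] ⇄⁼ fromMaybe mz ++ c ∷ fromMaybe my ++ []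
xzy⇄zxy-x<c≤z {mz = nothing} _ _ _ _ _ = inj₁ refl
xzy⇄zxy-x<c≤z {c} {y} {z} {R} {R₁} {R₂} {just d} {my} sR c≤z y<z ez ey
  with bump-after-larger y<z R
... | (e , bumps-e , e≤z) with trans (sym (cong proj₂ ey)) (trans (sym (cong (λ t → proj₂ (rowIns y (proj₁ t))) ez)) bumps-e)
...   | refl =
  let c≤R₁ = subst (All (c ≤_)) (cong proj₁ ez) (proj₁ (All-rowIns z R (sorted-head≤ sR) c≤z))
  in inj₂ (inj₁ (xzy⇄zxy (All-bump y R₁ c≤R₁ ey) (≤-<-trans e≤z (bump-> z R ez))))

yxz⇄yzx-all<c : ∀ c R {x y z} → Sorted (c ∷ R) → x < y → y ≤ z → y < c → z < c →
                InsertAlike (c ∷ R) (y ∷ x ∷ z ∷ []) (y ∷ z ∷ x ∷ [])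
yxz⇄yzx-all<c c [] {x} {y} {z} _ x<y y≤z y<c z<c =
  let x≤z = ≤-trans (<⇒≤ x<y) y≤z in
  insertAlike (c ∷ []) (y ∷ x ∷ z ∷ []) (y ∷ z ∷ x ∷ [])
    (rowInsWord-three y x z (c ∷ []) (rowIns-< [] y<c) (rowIns-< [] x<y) (rowIns-≥ x≤z refl))
    (rowInsWord-three y z x (c ∷ []) (rowIns-< [] y<c) (rowIns-≥ y≤z refl) (rowIns-< (z ∷ []) x<y))
    (inj₁ refl)
yxz⇄yzx-all<c c (h ∷ R) {x} {y} {z} (c≤h ∷ _) x<y y≤z y<c z<c =
  let x≤z = ≤-trans (<⇒≤ x<y) y≤z
      z<h = <-≤-trans z<c c≤h in
  insertAlike (c ∷ h ∷ R) (y ∷ x ∷ z ∷ []) (y ∷ z ∷ x ∷ [])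
    (rowInsWord-three y x z (c ∷ h ∷ R) (rowIns-< (h ∷ R) y<c) (rowIns-< (h ∷ R) x<y) (rowIns-≥ x≤z (rowIns-< R z<h)))
    (rowInsWord-three y z x (c ∷ h ∷ R) (rowIns-< (h ∷ R) y<c) (rowIns-≥ y≤z (rowIns-< R z<h)) (rowIns-< (z ∷ R) x<y))
    (inj₂ (inj₁ (yxz⇄yzx y<c c≤h)))

yxz⇄yzx-x<c≤y : ∀ {c y z R R₁ R₂ my mz} → Sorted (c ∷ R) → c ≤ y → y ≤ z →
                   rowIns y R ≡ (R₁ , my) → rowIns z R₁ ≡ (R₂ , mz) →
                   fromMaybe my ++ c ∷ fromMaybe mz ++ [] ⇄⁼ fromMaybe my ++ fromMaybe mz ++ c ∷ []
yxz⇄yzx-x<c≤y {mz = nothing} _ _ _ _ _ = inj₁ refl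
yxz⇄yzx-x<c≤y {R = R} {my = nothing} {just e} _ _ y≤z ey ez with trans (sym (cong proj₂ ez)) (noBump-mono R ey y≤z)
... | ()
yxz⇄yzx-x<c≤y {R = R} {my = just d} {just e} sR c≤y y≤z ey ez =
  inj₂ (inj₁ (yxz⇄yzx (≤-<-trans c≤y (bump-> _ R ey)) (bump-mono R (Linked.tail sR) ey y≤z ez)))

yxz⇄yzx-y<c≤z : ∀ {c y z R R₂ mz} → Sorted (c ∷ R) → y < c → rowIns z R ≡ (R₂ , mz) →
                c ∷ y ∷ fromMaybe mz ++ [] ⇄⁼ c ∷ fromMaybe mz ++ y ∷ []
yxz⇄yzx-y<c≤z {mz = nothing} _ _ _ = inj₁ refl
yxz⇄yzx-y<c≤z {R = R} {mz = just e} sR y<c ez = inj₂ (inj₁ (yxz⇄yzx y<c (All-bump _ R (sorted-head≤ sR) ez)))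

insertAlike-[] : ∀ {u v} → u ⇄ v → InsertAlike [] u v
insertAlike-[] u⇄v = cong proj₁ (rowInsWord-[]-⇄ u⇄v) , inj₁ (cong proj₂ (rowInsWord-[]-⇄ u⇄v))

rowInsWord-xzy⇄zxy : ∀ R → Sorted R → ∀ {x y z} → x ≤ y → y < z → InsertAlike R (x ∷ z ∷ y ∷ []) (z ∷ x ∷ y ∷ [])
rowInsWord-xzy⇄zxy [] _ x≤y y<z = insertAlike-[] (xzy⇄zxy x≤y y<z)
rowInsWord-xzy⇄zxy (c ∷ R) sR {x} {y} {z} x≤y y<z with <⊎≥ x c
... | inj₂ c≤x =
  let c≤y = ≤-trans c≤x x≤y
      c≤z = ≤-trans c≤y (<⇒≤ y<z)
  in insertAlike-skip c R _ _ (c≤x ∷ c≤z ∷ c≤y ∷ []) (c≤z ∷ c≤x ∷ c≤y ∷ [])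
                      (rowInsWord-xzy⇄zxy R (Linked.tail sR) x≤y y<z)
... | inj₁ x<c with <⊎≥ z c
...   | inj₁ z<c = xzy⇄zxy-all<c c R sR x≤y y<z x<c z<c
...   | inj₂ c≤z with rowIns z R in ez
...     | (R₁ , mz) with rowIns y R₁ in ey
...       | (R₂ , my) =
  let x≤z = ≤-trans x≤y (<⇒≤ y<z) in
  insertAlike (c ∷ R) (x ∷ z ∷ y ∷ []) (z ∷ x ∷ y ∷ [])
    (rowInsWord-three x z y (c ∷ R) (rowIns-< R x<c) (rowIns-≥ x≤z ez) (rowIns-≥ x≤y ey))
    (rowInsWord-three z x y (c ∷ R) (rowIns-≥ c≤z ez) (rowIns-< R₁ x<c) (rowIns-≥ x≤y ey))
    (xzy⇄zxy-x<c≤z sR c≤z y<z ez ey)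

rowInsWord-yxz⇄yzx : ∀ R → Sorted R → ∀ {x y z} → x < y → y ≤ z → InsertAlike R (y ∷ x ∷ z ∷ []) (y ∷ z ∷ x ∷ [])
rowInsWord-yxz⇄yzx [] _ x<y y≤z = insertAlike-[] (yxz⇄yzx x<y y≤z)
rowInsWord-yxz⇄yzx (c ∷ R) sR {x} {y} {z} x<y y≤z with <⊎≥ x c
... | inj₂ c≤x =
  let c≤y = ≤-trans c≤x (<⇒≤ x<y)
      c≤z = ≤-trans c≤y y≤z
  in insertAlike-skip c R _ _ (c≤y ∷ c≤x ∷ c≤z ∷ []) (c≤y ∷ c≤z ∷ c≤x ∷ [])
                      (rowInsWord-yxz⇄yzx R (Linked.tail sR) x<y y≤z)
... | inj₁ x<c with <⊎≥ y c
...   | inj₂ c≤y with rowIns y R in ey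
...     | (R₁ , my) with rowIns z R₁ in ez
...       | (R₂ , mz) =
  let x≤z = ≤-trans (<⇒≤ x<y) y≤z
      c≤z = ≤-trans c≤y y≤z in
  insertAlike (c ∷ R) (y ∷ x ∷ z ∷ []) (y ∷ z ∷ x ∷ [])
    (rowInsWord-three y x z (c ∷ R) (rowIns-≥ c≤y ey) (rowIns-< R₁ x<c) (rowIns-≥ x≤z ez))
    (rowInsWord-three y z x (c ∷ R) (rowIns-≥ c≤y ey) (rowIns-≥ c≤z ez) (rowIns-< R₂ x<c))
    (yxz⇄yzx-x<c≤y sR c≤y y≤z ey ez)
rowInsWord-yxz⇄yzx (c ∷ R) sR {x} {y} {z} x<y y≤z | inj₁ x<c | inj₁ y<c with <⊎≥ z c
... | inj₁ z<c = yxz⇄yzx-all<c c R sR x<y y≤z y<c z<c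
... | inj₂ c≤z with rowIns z R in ez
...   | (R₂ , mz) =
  let x≤z = ≤-trans (<⇒≤ x<y) y≤z in
  insertAlike (c ∷ R) (y ∷ x ∷ z ∷ []) (y ∷ z ∷ x ∷ [])
    (rowInsWord-three y x z (c ∷ R) (rowIns-< R y<c) (rowIns-< R x<y) (rowIns-≥ x≤z ez))
    (rowInsWord-three y z x (c ∷ R) (rowIns-< R y<c) (rowIns-≥ y≤z ez) (rowIns-< R₂ x<y))
    (yxz⇄yzx-y<c≤z sR y<c ez)

rowInsWord-⇄ : ∀ R {u v} → Sorted R → u ⇄ v → InsertAlike R u v
rowInsWord-⇄ R sR (xzy⇄zxy x≤y y<z) = rowInsWord-xzy⇄zxy R sR x≤y y<z
rowInsWord-⇄ R sR (yxz⇄yzx x<y y≤z) = rowInsWord-yxz⇄yzx R sR x<y y≤z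

insWord-[] : ∀ r → NonEmpty r → insWord [] r ≡ insWord ([] ∷ []) r
insWord-[] (x ∷ r) nonEmpty = refl

⇄-nonEmptyˡ : ∀ {u v} → u ⇄ v → NonEmpty u
⇄-nonEmptyˡ (xzy⇄zxy _ _) = nonEmpty
⇄-nonEmptyˡ (yxz⇄yzx _ _) = nonEmpty

⇄-nonEmptyʳ : ∀ {u v} → u ⇄ v → NonEmpty v
⇄-nonEmptyʳ (xzy⇄zxy _ _) = nonEmpty
⇄-nonEmptyʳ (yxz⇄yzx _ _) = nonEmpty

insWord-⇄ : ∀ S {u v} → All Sorted S → u ⇄ v → insWord S u ≡ insWord S v
insWord-⇄ [] {u} {v} _ u⇄v = begin
  insWord [] u                                  ≡⟨ insWord-[] u (⇄-nonEmptyˡ u⇄v) ⟩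
  insWord ([] ∷ []) u                           ≡⟨ insWord-∷ [] [] u ⟩
  proj₁ (rowInsWord [] u) ∷ insWord [] (proj₂ (rowInsWord [] u))
    ≡⟨ cong (λ p → proj₁ p ∷ insWord [] (proj₂ p)) (rowInsWord-[]-⇄ u⇄v) ⟩
  proj₁ (rowInsWord [] v) ∷ insWord [] (proj₂ (rowInsWord [] v)) ≡⟨ insWord-∷ [] [] v ⟨
  insWord ([] ∷ []) v                           ≡⟨ insWord-[] v (⇄-nonEmptyʳ u⇄v) ⟨
  insWord [] v                                  ∎
  where open ≡-Reasoning
insWord-⇄ (R ∷ S) {u} {v} (sR ∷ sS) u⇄v with rowInsWord-⇄ R sR u⇄v
... | (same , related) =
  trans (insWord-∷ R S u) (trans (cong₂ _∷_ same (lower related)) (sym (insWord-∷ R S v)))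
  where
  lower : ∀ {β γ} → β ⇄⁼ γ → insWord S β ≡ insWord S γ
  lower (inj₁ β≡γ) = cong (insWord S) β≡γ
  lower (inj₂ (inj₁ β⇄γ)) = insWord-⇄ S sS β⇄γ
  lower (inj₂ (inj₂ γ⇄β)) = sym (insWord-⇄ S sS γ⇄β)

data _≈ᴷ_ : List ℤ → List ℤ → Set where
  ≈ᴷ-refl : ∀ {w} → w ≈ᴷ w
  ≈ᴷ-sym : ∀ {u v} → u ≈ᴷ v → v ≈ᴷ u
  ≈ᴷ-trans : ∀ {u v w} → u ≈ᴷ v → v ≈ᴷ w → u ≈ᴷ w
  ≈ᴷ-move : ∀ p q {u v} → u ⇄ v → p ++ u ++ q ≈ᴷ p ++ v ++ q

≡⇒≈ᴷ : ∀ {u v} → u ≡ v → u ≈ᴷ v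
≡⇒≈ᴷ refl = ≈ᴷ-refl

≈ᴷ-++ʳ : ∀ {u v} q → u ≈ᴷ v → u ++ q ≈ᴷ v ++ q
≈ᴷ-++ʳ q ≈ᴷ-refl = ≈ᴷ-refl
≈ᴷ-++ʳ q (≈ᴷ-sym k) = ≈ᴷ-sym (≈ᴷ-++ʳ q k)
≈ᴷ-++ʳ q (≈ᴷ-trans k l) = ≈ᴷ-trans (≈ᴷ-++ʳ q k) (≈ᴷ-++ʳ q l)
≈ᴷ-++ʳ q (≈ᴷ-move p q′ {u} {v} u⇄v) =
  ≈ᴷ-trans (≡⇒≈ᴷ (reassoc u))
  (≈ᴷ-trans (≈ᴷ-move p (q′ ++ q) u⇄v) (≡⇒≈ᴷ (sym (reassoc v))))
  where
  reassoc : ∀ u → (p ++ u ++ q′) ++ q ≡ p ++ u ++ q′ ++ q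
  reassoc u = trans (++-assoc p (u ++ q′) q) (cong (p ++_) (++-assoc u q′ q))

≈ᴷ-++ˡ : ∀ {u v} p → u ≈ᴷ v → p ++ u ≈ᴷ p ++ v
≈ᴷ-++ˡ p ≈ᴷ-refl = ≈ᴷ-refl
≈ᴷ-++ˡ p (≈ᴷ-sym k) = ≈ᴷ-sym (≈ᴷ-++ˡ p k)
≈ᴷ-++ˡ p (≈ᴷ-trans k l) = ≈ᴷ-trans (≈ᴷ-++ˡ p k) (≈ᴷ-++ˡ p l)
≈ᴷ-++ˡ p (≈ᴷ-move p′ q {u} {v} u⇄v) =
  ≈ᴷ-trans (≡⇒≈ᴷ (sym (++-assoc p p′ (u ++ q))))
  (≈ᴷ-trans (≈ᴷ-move (p ++ p′) q u⇄v) (≡⇒≈ᴷ (++-assoc p p′ (v ++ q))))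

insWord-resp-≈ᴷ : ∀ S {u v} → All Sorted S → u ≈ᴷ v → insWord S u ≡ insWord S v
insWord-resp-≈ᴷ S sS ≈ᴷ-refl = refl
insWord-resp-≈ᴷ S sS (≈ᴷ-sym k) = sym (insWord-resp-≈ᴷ S sS k)
insWord-resp-≈ᴷ S sS (≈ᴷ-trans k l) = trans (insWord-resp-≈ᴷ S sS k) (insWord-resp-≈ᴷ S sS l)
insWord-resp-≈ᴷ S sS (≈ᴷ-move p q {u} {v} u⇄v) = begin
  insWord S (p ++ u ++ q)              ≡⟨ insWord-++ S p (u ++ q) ⟩
  insWord (insWord S p) (u ++ q)       ≡⟨ insWord-++ (insWord S p) u q ⟩
  insWord (insWord (insWord S p) u) q  ≡⟨ cong (λ Z → insWord Z q) (insWord-⇄ (insWord S p) (insWord-sorted S p sS) u⇄v) ⟩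
  insWord (insWord (insWord S p) v) q  ≡⟨ insWord-++ (insWord S p) v q ⟨
  insWord (insWord S p) (v ++ q)       ≡⟨ insWord-++ S p (v ++ q) ⟨
  insWord S (p ++ v ++ q)              ∎
  where open ≡-Reasoning

sorted-snoc-≈ᴷ : ∀ c R x → x < c → Sorted (c ∷ R) → c ∷ R ++ [ x ] ≈ᴷ c ∷ x ∷ R
sorted-snoc-≈ᴷ c [] x _ _ = ≈ᴷ-refl
sorted-snoc-≈ᴷ c (d ∷ R) x x<c (c≤d ∷ sR) =
  ≈ᴷ-trans (≈ᴷ-++ˡ [ c ] (sorted-snoc-≈ᴷ d R x (<-≤-trans x<c c≤d) sR))
           (≈ᴷ-sym (≈ᴷ-move [] R (yxz⇄yzx x<c c≤d)))

rowIns-≈ᴷ : ∀ R x {R′ y} → Sorted R → rowIns x R ≡ (R′ , just y) → R ++ [ x ] ≈ᴷ y ∷ R′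
rowIns-≈ᴷ [] x _ ()
rowIns-≈ᴷ (c ∷ R) x sR eq with x <? c
rowIns-≈ᴷ (c ∷ R) x sR refl | yes x<c = sorted-snoc-≈ᴷ c R x x<c sR
... | no x≮c with rowIns x R in e
...   | (_ , just _) with eq
...     | refl with bumpedRow-head R (≮⇒≥ x≮c) (sorted-head≤ sR) e
...       | (_ , R″ , refl , c≤e , e<y) =
  ≈ᴷ-trans (≈ᴷ-++ˡ [ c ] (rowIns-≈ᴷ R x (Linked.tail sR) e)) (≈ᴷ-move [] R″ (xzy⇄zxy c≤e e<y))

readingWord-ins : ∀ x S → All Sorted S → readingWord (ins x S) ≈ᴷ readingWord S ++ [ x ]
readingWord-ins x [] _ = ≈ᴷ-refl
readingWord-ins x (R ∷ S) (sR ∷ sS) with rowIns x R in eq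
... | (R′ , nothing) = ≡⇒≈ᴷ (begin
  readingWord (R′ ∷ S)          ≡⟨ readingWord-∷ R′ S ⟩
  readingWord S ++ R′           ≡⟨ cong (readingWord S ++_) (rowIns-append x R eq) ⟩
  readingWord S ++ R ++ [ x ]   ≡⟨ ++-assoc (readingWord S) R [ x ] ⟨
  (readingWord S ++ R) ++ [ x ] ≡⟨ cong (_++ [ x ]) (readingWord-∷ R S) ⟨
  readingWord (R ∷ S) ++ [ x ]  ∎)
  where open ≡-Reasoning
... | (R′ , just y) =
  ≈ᴷ-trans (≡⇒≈ᴷ (readingWord-∷ R′ (ins y S)))
  (≈ᴷ-trans (≈ᴷ-++ʳ R′ (readingWord-ins y S sS))
  (≈ᴷ-trans (≡⇒≈ᴷ (++-assoc (readingWord S) [ y ] R′))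
  (≈ᴷ-trans (≈ᴷ-++ˡ (readingWord S) (≈ᴷ-sym (rowIns-≈ᴷ R x sR eq)))
            (≡⇒≈ᴷ (trans (sym (++-assoc (readingWord S) R [ x ])) (cong (_++ [ x ]) (sym (readingWord-∷ R S))))))))

readingWord-insWord : ∀ R u → All Sorted R → readingWord (insWord R u) ≈ᴷ readingWord R ++ u
readingWord-insWord R [] _ = ≡⇒≈ᴷ (sym (++-identityʳ (readingWord R)))
readingWord-insWord R (x ∷ u) sR =
  ≈ᴷ-trans (readingWord-insWord (ins x R) u (ins-sorted x R sR))
  (≈ᴷ-trans (≈ᴷ-++ʳ u (readingWord-ins x R sR)) (≡⇒≈ᴷ (++-assoc (readingWord R) [ x ] u)))

·-insWord-assoc : ∀ S R u → All Sorted S → All Sorted R → S · insWord R u ≡ insWord (S · R) u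
·-insWord-assoc S R u sS sR =
  trans (insWord-resp-≈ᴷ S sS (readingWord-insWord R u sR)) (insWord-++ S (readingWord R) u)

-- Placing tableaux side by side

infixr 6 _∥_

_∥_ : Tab → Tab → Tab
[] ∥ Ts = Ts
(l ∷ Ls) ∥ [] = l ∷ Ls ∥ []
(l ∷ Ls) ∥ (t ∷ Ts) = (l ++ t) ∷ Ls ∥ Ts

∥-identityʳ : ∀ Ls → Ls ∥ [] ≡ Ls
∥-identityʳ [] = refl
∥-identityʳ (l ∷ Ls) = cong (l ∷_) (∥-identityʳ Ls)

RowsJoinable : Tab → Tab → Set
RowsJoinable [] _ = ⊤
RowsJoinable (l ∷ Ls) [] = ⊤
RowsJoinable (l ∷ Ls) (t ∷ Ts) = All (λ e → All (e ≤_) t) l × RowsJoinable Ls Ts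

rowInsWord-replace-end : ∀ p r s → All (λ e → All (e ≤_) r) p → Sorted r → ColStrict r s →
                         rowInsWord (p ++ s) r ≡ (p ++ r , s)
rowInsWord-replace-end p r s p≤r sr rs = begin
  rowInsWord (p ++ s) r         ≡⟨ cong (λ z → rowInsWord (p ++ z) r) (++-identityʳ s) ⟨
  rowInsWord (p ++ s ++ []) r   ≡⟨ rowInsWord-replace p r s [] p≤r sr rs (inj₂ refl) ⟩
  (p ++ r ++ [] , s)            ≡⟨ cong (λ z → p ++ z , s) (++-identityʳ r) ⟩
  (p ++ r , s)                  ∎
  where open ≡-Reasoning

insWord-∥-rowʳ : ∀ Ls Ts r → IsTableau (r ∷ Ts) → RowsJoinable Ls (r ∷ Ts) → insWord (Ls ∥ Ts) r ≡ Ls ∥ (r ∷ Ts)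
insWord-∥-rowʳ [] [] r (nr ∷ _ , sr ∷ _ , _) _ =
  trans (insWord-[] r nr) (insWord-∷-≡ [] [] r (rowInsWord-replace-end [] r [] [] sr []))
insWord-∥-rowʳ [] (t ∷ Ts) r (_ ∷ nT , sr ∷ sT , c ∷ cT) _ =
  trans (insWord-∷-≡ t Ts r (rowInsWord-replace-end [] r t [] sr c))
        (cong (r ∷_) (insWord-∥-rowʳ [] Ts t (nT , sT , cT) tt))
insWord-∥-rowʳ (l ∷ Ls) [] r (_ , sr ∷ _ , _) (l≤r , _) =
  trans (cong (λ z → insWord (z ∷ Ls ∥ []) r) (sym (++-identityʳ l)))
        (insWord-∷-≡ (l ++ []) (Ls ∥ []) r (rowInsWord-replace-end l r [] l≤r sr []))
insWord-∥-rowʳ (l ∷ Ls) (t ∷ Ts) r (_ ∷ nT , sr ∷ sT , c ∷ cT) (l≤r , j) =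
  trans (insWord-∷-≡ (l ++ t) (Ls ∥ Ts) r (rowInsWord-replace-end l r t l≤r sr c))
        (cong ((l ++ r) ∷_) (insWord-∥-rowʳ Ls Ts t (nT , sT , cT) j))

·-∥ : ∀ Ls Us → IsTableau Us → (∀ k → RowsJoinable Ls (drop k Us)) → Ls · Us ≡ Ls ∥ Us
·-∥ Ls [] _ _ = sym (∥-identityʳ Ls)
·-∥ Ls (u ∷ Us) tU@(_ ∷ nU , _ ∷ sU , cU) j = begin
  insWord Ls (readingWord (u ∷ Us))       ≡⟨ cong (insWord Ls) (readingWord-∷ u Us) ⟩
  insWord Ls (readingWord Us ++ u)        ≡⟨ insWord-++ Ls (readingWord Us) u ⟩
  insWord (Ls · Us) u                     ≡⟨ cong (λ Z → insWord Z u) (·-∥ Ls Us (nU , sU , Linked.tail cU) (j ∘ suc)) ⟩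
  insWord (Ls ∥ Us) u                     ≡⟨ insWord-∥-rowʳ Ls Us u tU (j 0) ⟩
  Ls ∥ (u ∷ Us)                           ∎
  where open ≡-Reasoning

[]-· : ∀ U → IsTableau U → [] · U ≡ U
[]-· U tU = ·-∥ [] U tU (λ _ → tt)

Flush : ℕ → Tab → Tab → Set
Flush n Ls [] = ⊤
Flush n [] (t ∷ Ts) = ⊥
Flush n (l ∷ Ls) (t ∷ Ts) = length l ≡ n × Flush n Ls Ts

Flush-tail : ∀ n Ls t Ts → Flush n Ls (t ∷ Ts) → Flush n Ls Ts
Flush-tail n [] t Ts ()
Flush-tail n (l ∷ Ls) t [] _ = tt
Flush-tail n (l ∷ Ls) t (t′ ∷ Ts) (e , f) = e , Flush-tail n Ls t′ Ts f

Flush-++ : ∀ n Us Ls Ts → All (λ u → length u ≡ n) Us → Flush n Ls Ts → Flush n (Us ++ Ls) Ts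
Flush-++ n [] Ls Ts _ f = f
Flush-++ n (u ∷ Us) Ls [] _ _ = tt
Flush-++ n (u ∷ Us) Ls (t ∷ Ts) (e ∷ es) f = e , Flush-tail n (Us ++ Ls) t Ts (Flush-++ n Us Ls (t ∷ Ts) es f)

insWord-∥-rowˡ : ∀ Ls Ts u → IsTableau (u ∷ Ls) → Flush (length u) Ls Ts → insWord (Ls ∥ Ts) u ≡ (u ∷ Ls) ∥ Ts
insWord-∥-rowˡ Ls [] u tL _ = begin
  insWord (Ls ∥ []) u   ≡⟨ cong (λ Z → insWord Z u) (∥-identityʳ Ls) ⟩
  insWord Ls u          ≡⟨ insWord-∥-rowʳ [] Ls u tL tt ⟩
  u ∷ Ls                ≡⟨ ∥-identityʳ (u ∷ Ls) ⟨
  (u ∷ Ls) ∥ []         ∎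
  where open ≡-Reasoning
insWord-∥-rowˡ [] (t ∷ Ts) u _ ()
insWord-∥-rowˡ (l ∷ Ls) (t ∷ Ts) u (_ ∷ nL , su ∷ sL , c ∷ cL) (e , f) =
  trans (insWord-∷-≡ (l ++ t) (Ls ∥ Ts) u (rowInsWord-replace [] u l t [] su c (inj₁ e)))
        (cong ((u ++ t) ∷_) (insWord-∥-rowˡ Ls Ts l (nL , sL , cL) (subst (λ m → Flush m Ls Ts) (sym e) f)))

insWord-∥-stackˡ : ∀ n Us Ls Ts → All (λ u → length u ≡ n) Us → Flush n Ls Ts → IsTableau (Us ++ Ls) →
                   insWord (Ls ∥ Ts) (readingWord Us) ≡ (Us ++ Ls) ∥ Ts
insWord-∥-stackˡ n [] Ls Ts _ _ _ = refl
insWord-∥-stackˡ n (u ∷ Us) Ls Ts (e ∷ es) f tUL@(_ ∷ nUL , _ ∷ sUL , cUL) = begin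
  insWord (Ls ∥ Ts) (readingWord (u ∷ Us))           ≡⟨ cong (insWord (Ls ∥ Ts)) (readingWord-∷ u Us) ⟩
  insWord (Ls ∥ Ts) (readingWord Us ++ u)            ≡⟨ insWord-++ (Ls ∥ Ts) (readingWord Us) u ⟩
  insWord (insWord (Ls ∥ Ts) (readingWord Us)) u
    ≡⟨ cong (λ Z → insWord Z u) (insWord-∥-stackˡ n Us Ls Ts es f (nUL , sUL , Linked.tail cUL)) ⟩
  insWord ((Us ++ Ls) ∥ Ts) u
    ≡⟨ insWord-∥-rowˡ (Us ++ Ls) Ts u tUL (subst (λ m → Flush m (Us ++ Ls) Ts) (sym e) (Flush-++ n Us Ls Ts es f)) ⟩
  (u ∷ Us ++ Ls) ∥ Ts                                ∎
  where open ≡-Reasoning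

All-rowInsWord : ∀ {P : ℤ → Set} R w → All P R → All P w →
                 All P (proj₁ (rowInsWord R w)) × All P (proj₂ (rowInsWord R w))
All-rowInsWord R [] pR _ = pR , []
All-rowInsWord R (x ∷ w) pR (px ∷ pw) with All-rowIns x R pR px
... | (pR′ , pm) with All-rowInsWord (proj₁ (rowIns x R)) w pR′ pw
...   | (pR″ , pβ) = pR″ , AllP.++⁺ pm pβ

All-ins : ∀ {P : ℤ → Set} x S → All (All P) S → P x → All (All P) (ins x S)
All-ins x [] _ px = (px ∷ []) ∷ []
All-ins x (R ∷ S) (pR ∷ pS) px with rowIns x R | All-rowIns x R pR px
... | (_ , nothing) | (pR′ , _) = pR′ ∷ pS
... | (_ , just y) | (pR′ , py ∷ []) = pR′ ∷ All-ins y S pS py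

All-insWord : ∀ {P : ℤ → Set} S w → All (All P) S → All P w → All (All P) (insWord S w)
All-insWord S [] pS _ = pS
All-insWord S (x ∷ w) pS (px ∷ pw) = All-insWord (ins x S) w (All-ins x S pS px) pw

All-readingWord : ∀ {P : ℤ → Set} Y → All (All P) Y → All P (readingWord Y)
All-readingWord [] _ = []
All-readingWord (R ∷ Y) (pR ∷ pY) = subst (All _) (sym (readingWord-∷ R Y)) (AllP.++⁺ (All-readingWord Y pY) pR)

rowIns-↭ : ∀ x R → proj₁ (rowIns x R) ++ fromMaybe (proj₂ (rowIns x R)) ↭ x ∷ R
rowIns-↭ x [] = ↭-refl
rowIns-↭ x (h ∷ R) with x <? h
... | yes _ = prep x (↭-sym (↭.∷↭∷ʳ h R))
... | no _ = ↭-trans (prep h (rowIns-↭ x R)) (swap h x ↭-refl)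

ins-↭ : ∀ x S → concat (ins x S) ↭ x ∷ concat S
ins-↭ x [] = ↭-refl
ins-↭ x (R ∷ S) with rowIns x R | rowIns-↭ x R
... | (R′ , nothing) | R′↭ = ↭.++⁺ʳ (concat S) (↭-trans (↭-sym (↭.++-identityʳ R′)) R′↭)
... | (R′ , just y) | R′↭ = begin
  R′ ++ concat (ins y S)       ↭⟨ ↭.++⁺ˡ R′ (ins-↭ y S) ⟩
  R′ ++ y ∷ concat S           ≡⟨ ++-assoc R′ [ y ] (concat S) ⟨
  (R′ ++ [ y ]) ++ concat S    ↭⟨ ↭.++⁺ʳ (concat S) R′↭ ⟩
  x ∷ R ++ concat S            ∎
  where open PermutationReasoning

insWord-↭ : ∀ S w → concat (insWord S w) ↭ concat S ++ w
insWord-↭ S [] = ↭-sym (↭.++-identityʳ (concat S))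
insWord-↭ S (x ∷ w) = begin
  concat (insWord (ins x S) w)   ↭⟨ insWord-↭ (ins x S) w ⟩
  concat (ins x S) ++ w          ↭⟨ ↭.++⁺ʳ w (ins-↭ x S) ⟩
  x ∷ concat S ++ w              ↭⟨ ↭.shift x (concat S) w ⟨
  concat S ++ x ∷ w              ∎
  where open PermutationReasoning

readingWord-↭ : ∀ Y → readingWord Y ↭ concat Y
readingWord-↭ [] = ↭-refl
readingWord-↭ (R ∷ Y) = begin
  readingWord (R ∷ Y)     ≡⟨ readingWord-∷ R Y ⟩
  readingWord Y ++ R      ↭⟨ ↭.++⁺ʳ R (readingWord-↭ Y) ⟩
  concat Y ++ R           ↭⟨ ↭.++-comm (concat Y) R ⟩
  R ++ concat Y           ∎
  where open PermutationReasoning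

·-↭ : ∀ A B → concat (A · B) ↭ concat A ++ concat B
·-↭ A B = ↭-trans (insWord-↭ A (readingWord B)) (↭.++⁺ˡ (concat A) (readingWord-↭ B))

concat-removeEmpty : ∀ L → concat (removeEmpty L) ≡ concat L
concat-removeEmpty [] = refl
concat-removeEmpty ([] ∷ L) = concat-removeEmpty L
concat-removeEmpty ((x ∷ xs) ∷ L) = cong (x ∷_) (cong (xs ++_) (concat-removeEmpty L))

cols-↭ : ∀ b L → concat L ↭ concat (colsLeft b L) ++ concat (colsRight b L)
cols-↭ b L = ↭-trans (split L) (↭-reflexive (sym (cong₂ _++_ (concat-removeEmpty (map (take b) L))
                                                                (concat-removeEmpty (map (drop b) L)))))
  where
  open PermutationReasoning
  split : ∀ L → concat L ↭ concat (map (take b) L) ++ concat (map (drop b) L)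
  split [] = ↭-refl
  split (r ∷ L) = begin
    r ++ concat L                                        ≡⟨ cong (_++ concat L) (take++drop≡id b r) ⟨
    (take b r ++ drop b r) ++ concat L                   ↭⟨ ↭.++⁺ˡ (take b r ++ drop b r) (split L) ⟩
    (take b r ++ drop b r) ++ tL ++ dL                   ≡⟨ ++-assoc (take b r) (drop b r) (tL ++ dL) ⟩
    take b r ++ drop b r ++ tL ++ dL                     ↭⟨ ↭.++⁺ˡ (take b r) (↭.shifts (drop b r) tL) ⟩
    take b r ++ tL ++ drop b r ++ dL                     ≡⟨ ++-assoc (take b r) tL (drop b r ++ dL) ⟨
    (take b r ++ tL) ++ drop b r ++ dL                   ∎
    where
    tL = concat (map (take b) L)
    dL = concat (map (drop b) L)

++-cancelˡ-↭ : ∀ xs {ys zs : List ℤ} → xs ++ ys ↭ xs ++ zs → ys ↭ zs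
++-cancelˡ-↭ [] p = p
++-cancelˡ-↭ (x ∷ xs) p = ++-cancelˡ-↭ xs (↭.drop-∷ p)

Linked-take : ∀ {A : Set} {R : A → A → Set} n {L} → Linked R L → Linked R (take n L)
Linked-take zero _ = []
Linked-take (suc n) [] = []
Linked-take (suc zero) [-] = [-]
Linked-take (suc (suc n)) [-] = [-]
Linked-take (suc zero) (_ ∷ _) = [-]
Linked-take (suc (suc n)) (r ∷ l) = r ∷ Linked-take (suc n) l

Linked-drop : ∀ {A : Set} {R : A → A → Set} n {L} → Linked R L → Linked R (drop n L)
Linked-drop zero l = l
Linked-drop (suc n) {[]} l = []
Linked-drop (suc n) {_ ∷ _} l = Linked-drop n (Linked.tail l)

take-IsTableau : ∀ n S → IsTableau S → IsTableau (take n S)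
take-IsTableau n S (nS , sS , cS) = AllP.take⁺ n nS , AllP.take⁺ n sS , Linked-take n cS

drop-IsTableau : ∀ n S → IsTableau S → IsTableau (drop n S)
drop-IsTableau n S (nS , sS , cS) = AllP.drop⁺ n nS , AllP.drop⁺ n sS , Linked-drop n cS

ColStrict-take : ∀ n {r s} → ColStrict r s → ColStrict (take n r) (take n s)
ColStrict-take zero _ = []
ColStrict-take (suc n) [] = []
ColStrict-take (suc n) (p ∷ c) = p ∷ ColStrict-take n c

ColStrict-drop : ∀ n {r s} → ColStrict r s → ColStrict (drop n r) (drop n s)
ColStrict-drop zero c = c
ColStrict-drop (suc n) [] = []
ColStrict-drop (suc n) (_ ∷ c) = ColStrict-drop n c

ColStrict-[]ˡ : ∀ {s} → ColStrict [] s → s ≡ []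
ColStrict-[]ˡ [] = refl

removeEmpty-nonEmpty : ∀ L → All NonEmpty L → removeEmpty L ≡ L
removeEmpty-nonEmpty [] _ = refl
removeEmpty-nonEmpty ((x ∷ xs) ∷ L) (_ ∷ nL) = cong ((x ∷ xs) ∷_) (removeEmpty-nonEmpty L nL)

All-removeEmpty : ∀ {P : List ℤ → Set} L → All P L → All P (removeEmpty L)
All-removeEmpty [] _ = []
All-removeEmpty ([] ∷ L) (_ ∷ pL) = All-removeEmpty L pL
All-removeEmpty ((x ∷ xs) ∷ L) (p ∷ pL) = p ∷ All-removeEmpty L pL

All-removeEmpty⁻ : ∀ {P : ℤ → Set} L → All (All P) (removeEmpty L) → All (All P) L
All-removeEmpty⁻ [] _ = []
All-removeEmpty⁻ ([] ∷ L) pL = [] ∷ All-removeEmpty⁻ L pL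
All-removeEmpty⁻ ((x ∷ xs) ∷ L) (p ∷ pL) = p ∷ All-removeEmpty⁻ L pL

removeEmpty-allNonEmpty : ∀ L → All NonEmpty (removeEmpty L)
removeEmpty-allNonEmpty [] = []
removeEmpty-allNonEmpty ([] ∷ L) = removeEmpty-allNonEmpty L
removeEmpty-allNonEmpty ((x ∷ xs) ∷ L) = nonEmpty ∷ removeEmpty-allNonEmpty L

removeEmpty-below-[] : ∀ L → Linked ColStrict ([] ∷ L) → removeEmpty L ≡ []
removeEmpty-below-[] [] _ = refl
removeEmpty-below-[] (r ∷ L) (c ∷ l) with ColStrict-[]ˡ c
... | refl = removeEmpty-below-[] L l

removeEmpty-colStrict : ∀ L → Linked ColStrict L → Linked ColStrict (removeEmpty L)
removeEmpty-colStrict [] _ = []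
removeEmpty-colStrict ([] ∷ L) l rewrite removeEmpty-below-[] L l = []
removeEmpty-colStrict ((x ∷ xs) ∷ []) _ = [-]
removeEmpty-colStrict ((x ∷ xs) ∷ [] ∷ L) (_ ∷ l) rewrite removeEmpty-below-[] L l = [-]
removeEmpty-colStrict ((x ∷ xs) ∷ (y ∷ ys) ∷ L) (c ∷ l) = c ∷ removeEmpty-colStrict ((y ∷ ys) ∷ L) l

removeEmpty-IsTableau : ∀ L → All Sorted L → Linked ColStrict L → IsTableau (removeEmpty L)
removeEmpty-IsTableau L sL cL = removeEmpty-allNonEmpty L , All-removeEmpty L sL , removeEmpty-colStrict L cL

colsLeft-IsTableau : ∀ b X → IsTableau X → IsTableau (colsLeft b X)
colsLeft-IsTableau b X (_ , sX , cX) =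
  removeEmpty-IsTableau (map (take b) X) (AllP.map⁺ (All.map (Linked-take b) sX))
                        (LinkedP.map⁺ (Linked.map (ColStrict-take b) cX))

colsRight-IsTableau : ∀ b X → IsTableau X → IsTableau (colsRight b X)
colsRight-IsTableau b X (_ , sX , cX) =
  removeEmpty-IsTableau (map (drop b) X) (AllP.map⁺ (All.map (Linked-drop b) sX))
                        (LinkedP.map⁺ (Linked.map (ColStrict-drop b) cX))

All-colsLeft : ∀ {P : ℤ → Set} b L → All (All P) L → All (All P) (colsLeft b L)
All-colsLeft b L pL = All-removeEmpty (map (take b) L) (AllP.map⁺ (All.map (AllP.take⁺ b) pL))

All-colsRight : ∀ {P : ℤ → Set} b L → All (All P) L → All (All P) (colsRight b L)
All-colsRight b L pL = All-removeEmpty (map (drop b) L) (AllP.map⁺ (All.map (AllP.drop⁺ b) pL))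

All-cols⁻ : ∀ {P : ℤ → Set} b L → All (All P) (colsLeft b L) → All (All P) (colsRight b L) → All (All P) L
All-cols⁻ {P} b L pl pr = join L (AllP.map⁻ (All-removeEmpty⁻ (map (take b) L) pl))
                                 (AllP.map⁻ (All-removeEmpty⁻ (map (drop b) L) pr))
  where
  join : ∀ L → All (All P ∘ take b) L → All (All P ∘ drop b) L → All (All P) L
  join [] _ _ = []
  join (r ∷ L) (p ∷ ps) (q ∷ qs) = subst (All P) (take++drop≡id b r) (AllP.++⁺ p q) ∷ join L ps qs

-- Cutting a tableau after column b

emptyRows : ℕ → Tab
emptyRows n = replicate n []

below-[]-empty : ∀ L → Linked ColStrict ([] ∷ L) → All (_≡ []) L
below-[]-empty [] _ = []
below-[]-empty (r ∷ L) (c ∷ l) with ColStrict-[]ˡ c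
... | refl = refl ∷ below-[]-empty L l

All-≡[]⇒emptyRows : ∀ L → All (_≡ []) L → L ≡ emptyRows (length L)
All-≡[]⇒emptyRows [] _ = refl
All-≡[]⇒emptyRows (r ∷ L) (refl ∷ eL) = cong ([] ∷_) (All-≡[]⇒emptyRows L eL)

removeEmpty-trailing : ∀ L → Linked ColStrict L → ∃[ j ] removeEmpty L ++ emptyRows j ≡ L
removeEmpty-trailing [] _ = 0 , refl
removeEmpty-trailing ([] ∷ L) l =
  suc (length L) ,
  trans (cong (_++ emptyRows (suc (length L))) (removeEmpty-below-[] L l))
        (cong ([] ∷_) (sym (All-≡[]⇒emptyRows L (below-[]-empty L l))))
removeEmpty-trailing ((x ∷ xs) ∷ L) l with removeEmpty-trailing L (Linked.tail l)
... | j , e = j , cong ((x ∷ xs) ∷_) e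

take-drop≡[] : ∀ b (r : List ℤ) → drop b r ≡ [] → take b r ≡ r
take-drop≡[] b r e = begin
  take b r             ≡⟨ ++-identityʳ (take b r) ⟨
  take b r ++ []       ≡⟨ cong (take b r ++_) e ⟨
  take b r ++ drop b r ≡⟨ take++drop≡id b r ⟩
  r                    ∎
  where open ≡-Reasoning

map-take-drop≡[] : ∀ b X → All (λ r → drop b r ≡ []) X → map (take b) X ≡ X
map-take-drop≡[] b [] _ = refl
map-take-drop≡[] b (r ∷ X) (e ∷ es) = cong₂ _∷_ (take-drop≡[] b r e) (map-take-drop≡[] b X es)

length-take-drop≢[] : ∀ b (r : List ℤ) {d ds} → drop b r ≡ d ∷ ds → length (take b r) ≡ b
length-take-drop≢[] zero r e = refl
length-take-drop≢[] (suc b) [] ()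
length-take-drop≢[] (suc b) (x ∷ r) e = cong suc (length-take-drop≢[] b r e)

module _ (b : ℕ) where

  private
    right-below-[] : ∀ r X → Linked ColStrict (r ∷ X) → drop b r ≡ [] →
                     Linked ColStrict ([] ∷ map (drop b) X)
    right-below-[] r X c e = subst (λ z → Linked ColStrict (z ∷ map (drop b) X)) e
                                   (LinkedP.map⁺ (Linked.map (ColStrict-drop b) c))

  cut-∥ : ∀ X → Linked ColStrict X → map (take b) X ∥ colsRight b X ≡ X
  cut-∥ [] _ = refl
  cut-∥ (r ∷ X) c with drop b r in e
  ... | [] =
    let below = right-below-[] r X c e in
    trans (cong (map (take b) (r ∷ X) ∥_) (removeEmpty-below-[] (map (drop b) X) below))
          (cong₂ _∷_ (take-drop≡[] b r e)
                     (trans (∥-identityʳ (map (take b) X))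
                            (map-take-drop≡[] b X (AllP.map⁻ (below-[]-empty (map (drop b) X) below)))))
  ... | _ ∷ _ = cong₂ _∷_ (trans (cong (take b r ++_) (sym e)) (take++drop≡id b r)) (cut-∥ X (Linked.tail c))

  cut-flush : ∀ X → Linked ColStrict X → Flush b (map (take b) X) (colsRight b X)
  cut-flush [] _ = tt
  cut-flush (r ∷ X) c with drop b r in e
  ... | [] = subst (Flush b (map (take b) (r ∷ X))) (sym (removeEmpty-below-[] (map (drop b) X) (right-below-[] r X c e))) tt
  ... | _ ∷ _ = length-take-drop≢[] b r e , cut-flush X (Linked.tail c)

data ColWeak : List ℤ → List ℤ → Set where
  [] : ∀ {r} → ColWeak r []
  _∷_ : ∀ {x y xs ys} → x ≤ y → ColWeak xs ys → ColWeak (x ∷ xs) (y ∷ ys)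

ColStrict⇒ColWeak : ∀ {r s} → ColStrict r s → ColWeak r s
ColStrict⇒ColWeak [] = []
ColStrict⇒ColWeak (p ∷ c) = <⇒≤ p ∷ ColStrict⇒ColWeak c

ColWeak-refl : ∀ r → ColWeak r r
ColWeak-refl [] = []
ColWeak-refl (x ∷ r) = ≤-refl ∷ ColWeak-refl r

ColWeak-trans : ∀ {r s t} → ColWeak r s → ColWeak s t → ColWeak r t
ColWeak-trans _ [] = []
ColWeak-trans (p ∷ d) (q ∷ e) = ≤-trans p q ∷ ColWeak-trans d e

ColWeak-below : ∀ {x X} → Linked ColStrict (x ∷ X) → All (ColWeak x) X
ColWeak-below [-] = []
ColWeak-below (c ∷ l) = ColStrict⇒ColWeak c ∷ All.map (ColWeak-trans (ColStrict⇒ColWeak c)) (ColWeak-below l)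

-- An entry among the first b of r is ≤ the entry of s in its column, hence ≤ all of drop b s.
ColWeak-joinable : ∀ b {r s} → Sorted s → ColWeak r s → All (λ e → All (e ≤_) (drop b s)) (take b r)
ColWeak-joinable zero _ _ = []
ColWeak-joinable (suc b) {r} _ [] = AllP.take⁺ (suc b) (All.universal (λ _ → []) r)
ColWeak-joinable (suc b) ss (p ∷ d) =
  AllP.drop⁺ b (All.map (≤-trans p) (sorted-head≤ ss)) ∷ ColWeak-joinable b (Linked.tail ss) d

RowsColWeak : Tab → Tab → Set
RowsColWeak X [] = ⊤
RowsColWeak [] (d ∷ D) = ⊥
RowsColWeak (x ∷ X) (d ∷ D) = ColWeak x d × RowsColWeak X D

RowsColWeak-drop : ∀ X m → Linked ColStrict X → RowsColWeak X (drop m X)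
RowsColWeak-drop [] zero _ = tt
RowsColWeak-drop [] (suc m) _ = tt
RowsColWeak-drop (x ∷ X) zero c = ColWeak-refl x , RowsColWeak-drop X zero (Linked.tail c)
RowsColWeak-drop (x ∷ X) (suc m) c =
  shift (drop m X) (AllP.drop⁺ m (ColWeak-below c))
        (subst (RowsColWeak X) drop-suc (RowsColWeak-drop X (suc m) (Linked.tail c)))
  where
  drop-suc : drop (suc m) X ≡ drop 1 (drop m X)
  drop-suc = trans (cong (λ k → drop k X) (+-comm 1 m)) (sym (drop-drop m 1 X))
  shift : ∀ D → All (ColWeak x) D → RowsColWeak X (drop 1 D) → RowsColWeak (x ∷ X) D
  shift [] _ _ = tt
  shift (d ∷ D) (w ∷ _) ws = w , ws

RowsColWeak-joinable : ∀ b X D → All Sorted D → RowsColWeak X D → RowsJoinable (map (take b) X) (map (drop b) D)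
RowsColWeak-joinable b [] [] _ _ = tt
RowsColWeak-joinable b (x ∷ X) [] _ _ = tt
RowsColWeak-joinable b (x ∷ X) (d ∷ D) (sd ∷ sD) (w , ws) = ColWeak-joinable b sd w , RowsColWeak-joinable b X D sD ws

RowsJoinable-++⁻ : ∀ Ls A C → RowsJoinable Ls (A ++ C) → RowsJoinable Ls A
RowsJoinable-++⁻ [] A C _ = tt
RowsJoinable-++⁻ (l ∷ Ls) [] C _ = tt
RowsJoinable-++⁻ (l ∷ Ls) (a ∷ A) C (p , j) = p , RowsJoinable-++⁻ Ls A C j

drop-++-prefix : ∀ {A : Set} n (xs ys : List A) → ∃[ zs ] drop n (xs ++ ys) ≡ drop n xs ++ zs
drop-++-prefix zero xs ys = ys , refl
drop-++-prefix (suc n) [] ys = drop (suc n) ys , refl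
drop-++-prefix (suc n) (x ∷ xs) ys = drop-++-prefix n xs ys

cut-joinable : ∀ b X n → All Sorted X → Linked ColStrict X → RowsJoinable (map (take b) X) (drop n (colsRight b X))
cut-joinable b X n sX cX with removeEmpty-trailing (map (drop b) X) (LinkedP.map⁺ (Linked.map (ColStrict-drop b) cX))
... | j , trailing with drop-++-prefix n (colsRight b X) (emptyRows j)
...   | C , prefix =
  RowsJoinable-++⁻ (map (take b) X) (drop n (colsRight b X)) C
    (subst (RowsJoinable (map (take b) X)) (trans (sym (drop-map n X)) (trans (cong (drop n) (sym trailing)) prefix))
           (RowsColWeak-joinable b X (drop n X) (AllP.drop⁺ n sX) (RowsColWeak-drop X n cX)))

ins-++-emptyRows : ∀ x S k → ∃[ k′ ] ins x (S ++ emptyRows k) ≡ ins x S ++ emptyRows k′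
ins-++-emptyRows x [] zero = zero , refl
ins-++-emptyRows x [] (suc k) = k , refl
ins-++-emptyRows x (R ∷ S) k with rowIns x R
... | (_ , nothing) = k , refl
... | (R′ , just y) with ins-++-emptyRows y S k
...   | k′ , eq = k′ , cong (R′ ∷_) eq

insWord-++-emptyRows : ∀ S k w → ∃[ k′ ] insWord (S ++ emptyRows k) w ≡ insWord S w ++ emptyRows k′
insWord-++-emptyRows S k [] = k , refl
insWord-++-emptyRows S k (x ∷ w) with ins-++-emptyRows x S k
... | k₁ , eq₁ with insWord-++-emptyRows (ins x S) k₁ w
...   | k₂ , eq₂ = k₂ , trans (cong (λ Z → insWord Z w) eq₁) eq₂

take-++-emptyRows : ∀ n k L → ∃[ j ] take n (L ++ emptyRows k) ≡ take n L ++ emptyRows j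
take-++-emptyRows zero k L = 0 , refl
take-++-emptyRows (suc n) zero [] = 0 , refl
take-++-emptyRows (suc n) (suc k) [] with take-++-emptyRows n k []
... | j , e = suc j , cong ([] ∷_) (trans e (cong (_++ emptyRows j) (take-[] n)))
take-++-emptyRows (suc n) k (R ∷ L) with take-++-emptyRows n k L
... | j , e = j , cong (R ∷_) e

length-take-++-emptyRows : ∀ n k L → n ℕ.≤ k → length (take n (L ++ emptyRows k)) ≡ n
length-take-++-emptyRows zero k L _ = refl
length-take-++-emptyRows (suc n) (suc k) [] (ℕ.s≤s n≤k) = cong suc (length-take-++-emptyRows n k [] n≤k)
length-take-++-emptyRows (suc n) k (R ∷ L) n<k = cong suc (length-take-++-emptyRows n k L (ℕP.<⇒≤ n<k))

drop-++-emptyRows : ∀ n L k → ∃[ j ] drop n (L ++ emptyRows k) ≡ drop n L ++ emptyRows j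
drop-++-emptyRows zero L k = k , refl
drop-++-emptyRows (suc n) [] k = k ℕ.∸ suc n , drop-emptyRows (suc n) k
  where
  drop-emptyRows : ∀ n k → drop n (emptyRows k) ≡ emptyRows (k ℕ.∸ n)
  drop-emptyRows zero k = refl
  drop-emptyRows (suc n) zero = refl
  drop-emptyRows (suc n) (suc k) = drop-emptyRows n k
drop-++-emptyRows (suc n) (R ∷ L) k = drop-++-emptyRows n L k

++-emptyRows-cancel : ∀ L B j j′ → All NonEmpty L → All NonEmpty B → L ++ emptyRows j ≡ B ++ emptyRows j′ → L ≡ B
++-emptyRows-cancel [] [] _ _ _ _ _ = refl
++-emptyRows-cancel (l ∷ L) (b ∷ B) j j′ (_ ∷ nL) (_ ∷ nB) e =
  cong₂ _∷_ (∷-injectiveˡ e) (++-emptyRows-cancel L B j j′ nL nB (∷-injectiveʳ e))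
++-emptyRows-cancel [] (b ∷ B) (suc j) j′ _ (nonEmpty ∷ _) ()
++-emptyRows-cancel [] (b ∷ B) zero j′ _ (nonEmpty ∷ _) ()
++-emptyRows-cancel (l ∷ L) [] j (suc j′) (nonEmpty ∷ _) _ ()
++-emptyRows-cancel (l ∷ L) [] j zero (nonEmpty ∷ _) _ ()

emptyRows-++⁻ : ∀ n A B m → All NonEmpty B → emptyRows n ≡ A ++ B ++ emptyRows m → removeEmpty A ≡ [] × B ≡ []
emptyRows-++⁻ n [] [] m _ _ = refl , refl
emptyRows-++⁻ zero [] (b ∷ B) m (nonEmpty ∷ _) ()
emptyRows-++⁻ (suc n) [] (b ∷ B) m (nonEmpty ∷ _) ()
emptyRows-++⁻ zero (r ∷ A) B m _ ()
emptyRows-++⁻ (suc n) ([] ∷ A) B m nB e = emptyRows-++⁻ n A B m nB (∷-injectiveʳ e)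
emptyRows-++⁻ (suc n) ((x ∷ xs) ∷ A) B m nB e with ∷-injectiveˡ e
... | ()

++-emptyRows-split : ∀ A B L j j′ → All NonEmpty L → All NonEmpty B → L ++ emptyRows j ≡ A ++ B ++ emptyRows j′ →
                     take (length A) L ≡ removeEmpty A × drop (length A) L ≡ B
++-emptyRows-split [] B L j j′ nL nB e = refl , ++-emptyRows-cancel L B j j′ nL nB e
++-emptyRows-split (r ∷ A) B (l ∷ L) j j′ (nonEmpty ∷ nL) nB e with ∷-injectiveˡ e
... | refl with ++-emptyRows-split A B L j j′ nL nB (∷-injectiveʳ e)
...   | (e₁ , e₂) = cong (_ ∷_) e₁ , e₂
++-emptyRows-split (r ∷ A) B [] zero j′ _ _ ()
++-emptyRows-split ((x ∷ xs) ∷ A) B [] (suc j) j′ _ _ e with ∷-injectiveˡ e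
... | ()
++-emptyRows-split ([] ∷ A) B [] (suc j) j′ _ nB e with emptyRows-++⁻ j A B j′ nB (∷-injectiveʳ e)
... | (e₁ , refl) = sym e₁ , refl

take-length-++ : ∀ {A : Set} (xs ys : List A) n → length xs ≡ n → take n (xs ++ ys) ≡ xs
take-length-++ [] ys zero _ = refl
take-length-++ (x ∷ xs) ys (suc n) e = cong (x ∷_) (take-length-++ xs ys n (suc-injective e))

drop-length-++ : ∀ {A : Set} (xs ys : List A) n → length xs ≡ n → drop n (xs ++ ys) ≡ ys
drop-length-++ [] ys zero _ = refl
drop-length-++ (x ∷ xs) ys (suc n) e = drop-length-++ xs ys n (suc-injective e)

-- Padding S with n empty rows makes the word pass through exactly n top rows before what they
-- bump is inserted into drop n S.
insWord-split : ∀ n S w → IsTableau S →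
                take n (insWord S w) ≡ removeEmpty (proj₁ (rowsInsWord (take n (S ++ emptyRows n)) w)) ×
                drop n (insWord S w) ≡ insWord (drop n S) (proj₂ (rowsInsWord (take n (S ++ emptyRows n)) w))
insWord-split n S w tS
  with insWord-++-emptyRows S n w | drop-++-emptyRows n S n
... | j , padded | j₂ , dropped
  with insWord-++-emptyRows (drop n S) j₂ (proj₂ (rowsInsWord (take n (S ++ emptyRows n)) w))
... | j₃ , padded-bottom =
  subst (λ m → take m (insWord S w) ≡ removeEmpty S′ × drop m (insWord S w) ≡ Z)
        (trans (length-rowsInsWord Sₙ w) (length-take-++-emptyRows n n S ℕP.≤-refl))
        (++-emptyRows-split S′ Z (insWord S w) j j₃ (proj₁ (insWord-IsTableau S w tS))
                            (proj₁ (insWord-IsTableau (drop n S) β (drop-IsTableau n S tS))) both)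
  where
  Sₙ = take n (S ++ emptyRows n)
  S′ = proj₁ (rowsInsWord Sₙ w)
  β = proj₂ (rowsInsWord Sₙ w)
  Z = insWord (drop n S) β
  both : insWord S w ++ emptyRows j ≡ S′ ++ Z ++ emptyRows j₃
  both = begin
    insWord S w ++ emptyRows j                                   ≡⟨ padded ⟨
    insWord (S ++ emptyRows n) w                                 ≡⟨ cong (λ Z → insWord Z w) (take++drop≡id n (S ++ emptyRows n)) ⟨
    insWord (Sₙ ++ drop n (S ++ emptyRows n)) w                  ≡⟨ insWord-rows-++ Sₙ (drop n (S ++ emptyRows n)) w ⟩
    S′ ++ insWord (drop n (S ++ emptyRows n)) β                  ≡⟨ cong (λ Z → S′ ++ insWord Z β) dropped ⟩
    S′ ++ insWord (drop n S ++ emptyRows j₂) β                   ≡⟨ cong (S′ ++_) padded-bottom ⟩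
    S′ ++ Z ++ emptyRows j₃                                      ∎
    where open ≡-Reasoning

length-∥ : ∀ Ps Ts → length Ps ≡ length Ts → length (Ps ∥ Ts) ≡ length Ps
length-∥ [] [] _ = refl
length-∥ (p ∷ Ps) (t ∷ Ts) e = cong suc (length-∥ Ps Ts (suc-injective e))

map-drop-∥ : ∀ b Ps Ts → All (λ p → length p ≡ b) Ps → length Ps ≡ length Ts → map (drop b) (Ps ∥ Ts) ≡ Ts
map-drop-∥ b [] [] _ _ = refl
map-drop-∥ b (p ∷ Ps) (t ∷ Ts) (e ∷ es) el =
  cong₂ _∷_ (drop-length-++ p t b e) (map-drop-∥ b Ps Ts es (suc-injective el))

∥-++ˡ : ∀ Ps Qs Ts → (Ps ++ Qs) ∥ Ts ≡ Ps ∥ take (length Ps) Ts ++ Qs ∥ drop (length Ps) Ts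
∥-++ˡ [] Qs Ts = refl
∥-++ˡ (p ∷ Ps) Qs [] =
  cong (p ∷_) (trans (∥-++ˡ Ps Qs []) (cong₂ (λ u v → Ps ∥ u ++ Qs ∥ v) (take-[] (length Ps)) (drop-[] (length Ps))))
∥-++ˡ (p ∷ Ps) Qs (t ∷ Ts) = cong ((p ++ t) ∷_) (∥-++ˡ Ps Qs Ts)

∥-++-emptyRows : ∀ Ps Ts j → length (Ts ++ emptyRows j) ℕ.≤ length Ps → Ps ∥ (Ts ++ emptyRows j) ≡ Ps ∥ Ts
∥-++-emptyRows Ps [] zero _ = refl
∥-++-emptyRows (p ∷ Ps) [] (suc j) (ℕ.s≤s le) = cong₂ _∷_ (++-identityʳ p) (∥-++-emptyRows Ps [] j le)
∥-++-emptyRows (p ∷ Ps) (t ∷ Ts) j (ℕ.s≤s le) = cong ((p ++ t) ∷_) (∥-++-emptyRows Ps Ts j le)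

∥-split : ∀ n Ps Qs Ts → length Ps ≡ n → (Ps ++ Qs) ∥ Ts ≡ Ps ∥ take n (Ts ++ emptyRows n) ++ Qs ∥ drop n Ts
∥-split n Ps Qs Ts refl with take-++-emptyRows n n Ts
... | j , padded =
  trans (∥-++ˡ Ps Qs Ts)
        (cong (_++ Qs ∥ drop n Ts) (sym (trans (cong (Ps ∥_) padded) (∥-++-emptyRows Ps (take n Ts) j short))))
  where
  short = ℕP.≤-reflexive (trans (cong length (sym padded)) (length-take-++-emptyRows n n Ts ℕP.≤-refl))

rowsInsWord-∥ : ∀ (G : ℤ → Set) Ps Ss w → length Ps ≡ length Ss →
                (∀ {e} → G e → All (All (_≤ e)) Ps) → All (All G) Ss → All G w →
                rowsInsWord (Ps ∥ Ss) w ≡ (Ps ∥ proj₁ (rowsInsWord Ss w) , proj₂ (rowsInsWord Ss w))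
rowsInsWord-∥ G [] [] w _ _ _ _ = refl
rowsInsWord-∥ G (p ∷ Ps) (s ∷ Ss) w el G⇒Ps≤ (gs ∷ gSs) gw
  rewrite rowInsWord-skip p s w (All.map (All.head ∘ G⇒Ps≤) gw)
        | rowsInsWord-∥ G Ps Ss (proj₂ (rowInsWord s w)) (suc-injective el) (All.tail ∘ G⇒Ps≤) gSs
                        (proj₂ (All-rowInsWord s w gs gw)) = refl

-- The corner

Above : Tab → ℤ → Set
Above T e = ∀ {t} → t ∈ concat T → t < e

AllSmaller⇒All : ∀ T U → AllSmaller T U → All (All (Above T)) U
AllSmaller⇒All T U s = AllP.concat⁻ (All.tabulate (λ u∈ t∈ → s t∈ u∈))

All⇒AllSmaller : ∀ T U → All (All (Above T)) U → AllSmaller T U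
All⇒AllSmaller T U a t∈ u∈ = All.lookup (AllP.concat⁺ a) u∈ t∈

corner-↭ : ∀ a b T W → colsLeft b (rowsTop a W) ≡ T →
           concat W ↭ concat T ++ concat (P₀ a b W) ++ concat (Q₀ a b W) ++ concat (Zpart a b W)
corner-↭ a b T W corner = begin
  concat W                                              ≡⟨ cong concat (take++drop≡id a W) ⟨
  concat (take a W ++ drop a W)                         ≡⟨ concat-++ (take a W) (drop a W) ⟨
  concat (take a W) ++ concat (drop a W)                ↭⟨ ↭.++⁺ (cols-↭ b (take a W)) (cols-↭ b (drop a W)) ⟩
  (concat (colsLeft b (take a W)) ++ concat (P₀ a b W)) ++ concat (Q₀ a b W) ++ concat (Zpart a b W)
    ≡⟨ cong (λ U → (concat U ++ concat (P₀ a b W)) ++ concat (Q₀ a b W) ++ concat (Zpart a b W)) corner ⟩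
  (concat T ++ concat (P₀ a b W)) ++ concat (Q₀ a b W) ++ concat (Zpart a b W)
    ≡⟨ ++-assoc (concat T) (concat (P₀ a b W)) _ ⟩
  concat T ++ concat (P₀ a b W) ++ concat (Q₀ a b W) ++ concat (Zpart a b W) ∎
  where open PermutationReasoning

-- The factors X, Y carry exactly the entries of W outside the corner.
factors-above : ∀ a b T W X Y → ContainsCorner a b T W → CornerSmallest a b T W → W ≡ X · T · Y →
                AllSmaller T X × AllSmaller T Y
factors-above a b T W X Y (_ , corner) (sQ , sP , sZ) refl =
  All⇒AllSmaller T X (AllP.concat⁻ (AllP.++⁻ˡ (concat X) X++Y-above)) ,
  All⇒AllSmaller T Y (AllP.concat⁻ (AllP.++⁻ʳ (concat X) X++Y-above))
  where
  open PermutationReasoning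
  X++Y↭outside : concat T ++ concat X ++ concat Y ↭ concat T ++ concat (P₀ a b W) ++ concat (Q₀ a b W) ++ concat (Zpart a b W)
  X++Y↭outside = begin
    concat T ++ concat X ++ concat Y          ↭⟨ ↭.shifts (concat T) (concat X) ⟩
    concat X ++ concat T ++ concat Y          ≡⟨ ++-assoc (concat X) (concat T) (concat Y) ⟨
    (concat X ++ concat T) ++ concat Y        ↭⟨ ↭.++⁺ʳ (concat Y) (·-↭ X T) ⟨
    concat (X · T) ++ concat Y                ↭⟨ ·-↭ (X · T) Y ⟨
    concat W                                  ↭⟨ corner-↭ a b T W corner ⟩
    concat T ++ concat (P₀ a b W) ++ concat (Q₀ a b W) ++ concat (Zpart a b W) ∎
  X++Y-above : All (Above T) (concat X ++ concat Y)
  X++Y-above = ↭.All-resp-↭ (↭-sym (++-cancelˡ-↭ (concat T) X++Y↭outside))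
                 (AllP.++⁺ (AllP.concat⁺ (AllSmaller⇒All T (P₀ a b W) sP))
                   (AllP.++⁺ (AllP.concat⁺ (AllSmaller⇒All T (Q₀ a b W) sQ)) (AllP.concat⁺ (AllSmaller⇒All T (Zpart a b W) sZ))))

ColStrict-< : ∀ r s → length s ℕ.≤ length r → All (λ e → All (e <_) s) r → ColStrict r s
ColStrict-< r [] _ _ = []
ColStrict-< (x ∷ r) (y ∷ s) (ℕ.s≤s le) ((x<y ∷ _) ∷ r<s) = x<y ∷ ColStrict-< r s le (All.map All.tail r<s)

colStrict-++ : ∀ A B → Linked ColStrict A → Linked ColStrict B → All (λ r → ColStrict r (headRow B)) A →
               Linked ColStrict (A ++ B)
colStrict-++ [] B _ cB _ = cB
colStrict-++ (r ∷ []) [] _ _ _ = [-]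
colStrict-++ (r ∷ []) (s ∷ B) _ cB (c ∷ []) = c ∷ cB
colStrict-++ (r ∷ r₂ ∷ A) B (c ∷ cA) cB (_ ∷ above) = c ∷ colStrict-++ (r₂ ∷ A) B cA cB above

rows-∈-concat : ∀ (L : Tab) → All (All (_∈ concat L)) L
rows-∈-concat L = All.tabulate (λ r∈ → All.tabulate (λ x∈ → ∈-concat⁺′ x∈ r∈))

colsLeft-suc : ∀ b X → All NonEmpty X → colsLeft (suc b) X ≡ map (take (suc b)) X
colsLeft-suc b X nX = removeEmpty-nonEmpty (map (take (suc b)) X) (AllP.map⁺ (All.map nonEmpty-take nX))
  where
  nonEmpty-take : ∀ {r} → NonEmpty r → NonEmpty (take (suc b) r)
  nonEmpty-take nonEmpty = nonEmpty

rect-rows : ∀ (T : Tab) a b → shape T ≡ replicate a b → All (λ r → length r ≡ b) T × length T ≡ a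
rect-rows [] zero b _ = [] , refl
rect-rows (r ∷ T) (suc a) b e with rect-rows T a b (∷-injectiveʳ e)
... | (widths , height) = ∷-injectiveˡ e ∷ widths , cong suc height

module Corner (a b′ : ℕ) (T : Tab) (tT : IsTableau T)
              (T-width : All (λ r → length r ≡ suc b′) T) (T-height : length T ≡ a) where

  private
    b : ℕ
    b = suc b′

  ·-corner : ∀ X → IsTableau X → All (All (Above T)) X → X · T ≡ (T ++ map (take b) X) ∥ colsRight b X
  ·-corner X tX@(nX , sX , cX) aX = begin
    insWord X (readingWord T)                                  ≡⟨ cong (λ Z → insWord Z (readingWord T)) (cut-∥ b X cX) ⟨
    insWord (map (take b) X ∥ colsRight b X) (readingWord T)
      ≡⟨ insWord-∥-stackˡ b T (map (take b) X) (colsRight b X) T-width (cut-flush b X cX) tTX₀ ⟩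
    (T ++ map (take b) X) ∥ colsRight b X                      ∎
    where
    open ≡-Reasoning
    tX₀ : IsTableau (map (take b) X)
    tX₀ = subst IsTableau (colsLeft-suc b′ X nX) (colsLeft-IsTableau b X tX)
    below-T : ∀ X → All (All (Above T)) X → All (λ r → ColStrict r (headRow (map (take b) X))) T
    below-T [] _ = All.map (λ _ → []) T-width
    below-T (x ∷ _) (ax ∷ _) =
      All.zipWith (λ (width , r∈) → ColStrict-< _ (take b x) (subst (length (take b x) ℕ.≤_) (sym width) short)
                                                 (All.map (λ t∈ → All.map (λ above → above t∈) (AllP.take⁺ b ax)) r∈))
                  (T-width , rows-∈-concat T)
      where
      short : length (take b x) ℕ.≤ b
      short = subst (ℕ._≤ b) (sym (length-take b x)) (ℕP.m⊓n≤m b (length x))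
    tTX₀ : IsTableau (T ++ map (take b) X)
    tTX₀ = AllP.++⁺ (proj₁ tT) (proj₁ tX₀) , AllP.++⁺ (proj₁ (proj₂ tT)) (proj₁ (proj₂ tX₀)) ,
           colStrict-++ T (map (take b) X) (proj₂ (proj₂ tT)) (proj₂ (proj₂ tX₀)) (below-T X aX)

  module Factors (X Y : Tab) (tX : IsTableau X) (tY : IsTableau Y)
           (aX : All (All (Above T)) X) (aY : All (All (Above T)) Y) where

    private
      X̃ = colsRight b X
      X₀ = map (take b) X
      w = readingWord Y
      X̃ₐ = take a (X̃ ++ emptyRows a)
      S′ = proj₁ (rowsInsWord X̃ₐ w)
      β = proj₂ (rowsInsWord X̃ₐ w)

      length-X̃ₐ : length X̃ₐ ≡ a
      length-X̃ₐ = length-take-++-emptyRows a a X̃ ℕP.≤-refl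

      length-S′ : length S′ ≡ a
      length-S′ = trans (length-rowsInsWord X̃ₐ w) length-X̃ₐ

      length-T∥S′ : length (T ∥ S′) ≡ a
      length-T∥S′ = trans (length-∥ T S′ (trans T-height (sym length-S′))) T-height

      T≤ : ∀ {e} → Above T e → All (All (_≤ e)) T
      T≤ above = All.map (All.map (λ t∈ → <⇒≤ (above t∈))) (rows-∈-concat T)

      X̃ₐ-above : All (All (Above T)) X̃ₐ
      X̃ₐ-above = AllP.take⁺ a (AllP.++⁺ (All-colsRight b X aX) (AllP.replicate⁺ a []))

    ·-corner-· : X · T · Y ≡ T ∥ S′ ++ insWord (X₀ ∥ drop a X̃) β
    ·-corner-· = begin
      insWord (X · T) w                                       ≡⟨ cong (λ Z → insWord Z w) (·-corner X tX aX) ⟩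
      insWord ((T ++ X₀) ∥ X̃) w                               ≡⟨ cong (λ Z → insWord Z w) (∥-split a T X₀ X̃ T-height) ⟩
      insWord (T ∥ X̃ₐ ++ X₀ ∥ drop a X̃) w                      ≡⟨ insWord-rows-++ (T ∥ X̃ₐ) (X₀ ∥ drop a X̃) w ⟩
      proj₁ (rowsInsWord (T ∥ X̃ₐ) w) ++ insWord (X₀ ∥ drop a X̃) (proj₂ (rowsInsWord (T ∥ X̃ₐ) w))
        ≡⟨ cong (λ p → proj₁ p ++ insWord (X₀ ∥ drop a X̃) (proj₂ p))
                (rowsInsWord-∥ (Above T) T X̃ₐ w (trans T-height (sym length-X̃ₐ)) T≤ X̃ₐ-above (All-readingWord Y aY)) ⟩
      T ∥ S′ ++ insWord (X₀ ∥ drop a X̃) β                     ∎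
      where open ≡-Reasoning

    P₀-corner : P₀ a b (X · T · Y) ≡ rowsTop a (X̃ · Y)
    P₀-corner = begin
      removeEmpty (map (drop b) (take a (X · T · Y)))   ≡⟨ cong (λ Z → removeEmpty (map (drop b) (take a Z))) ·-corner-· ⟩
      removeEmpty (map (drop b) (take a (T ∥ S′ ++ _)))
        ≡⟨ cong (removeEmpty ∘ map (drop b)) (take-length-++ (T ∥ S′) _ a length-T∥S′) ⟩
      removeEmpty (map (drop b) (T ∥ S′))
        ≡⟨ cong removeEmpty (map-drop-∥ b T S′ T-width (trans T-height (sym length-S′))) ⟩
      removeEmpty S′                                    ≡⟨ proj₁ (insWord-split a X̃ w (colsRight-IsTableau b X tX)) ⟨
      take a (X̃ · Y)                                    ∎
      where open ≡-Reasoning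

    rowsBottom-corner : colsLeft b X · rowsBottom a (X̃ · Y) ≡ rowsBottom a (X · T · Y)
    rowsBottom-corner = begin
      colsLeft b X · drop a (X̃ · Y)          ≡⟨ cong₂ _·_ (colsLeft-suc b′ X (proj₁ tX)) (proj₂ (insWord-split a X̃ w tX̃)) ⟩
      X₀ · insWord (drop a X̃) β              ≡⟨ ·-insWord-assoc X₀ (drop a X̃) β (AllP.map⁺ (All.map (Linked-take b) (proj₁ (proj₂ tX))))
                                                                                 (proj₁ (proj₂ (drop-IsTableau a X̃ tX̃))) ⟩
      insWord (X₀ · drop a X̃) β              ≡⟨ cong (λ Z → insWord Z β) (·-∥ X₀ (drop a X̃) (drop-IsTableau a X̃ tX̃) joinable) ⟩
      insWord (X₀ ∥ drop a X̃) β              ≡⟨ drop-length-++ (T ∥ S′) _ a length-T∥S′ ⟨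
      drop a (T ∥ S′ ++ insWord (X₀ ∥ drop a X̃) β) ≡⟨ cong (drop a) ·-corner-· ⟨
      drop a (X · T · Y)                     ∎
      where
      open ≡-Reasoning
      tX̃ = colsRight-IsTableau b X tX
      joinable : ∀ k → RowsJoinable X₀ (drop k (drop a X̃))
      joinable k = subst (RowsJoinable X₀) (sym (drop-drop a k X̃)) (cut-joinable b X (a ℕ.+ k) (proj₁ (proj₂ tX)) (proj₂ (proj₂ tX)))

    admissible-split : Admissible T (colsLeft b X) (X̃ · Y)
    admissible-split =
      colsLeft-IsTableau b X tX , insWord-IsTableau X̃ w (colsRight-IsTableau b X tX) ,
      All⇒AllSmaller T (colsLeft b X) (All-colsLeft b X aX) ,
      All⇒AllSmaller T (X̃ · Y) (All-insWord X̃ w (All-colsRight b X aX) (All-readingWord Y aY))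

IsTableau-[] : IsTableau []
IsTableau-[] = [] , [] , []

step-right-part : ∀ {T a b X Y} → Admissible T X Y → Step T a b (X , Y) (colsLeft b X , colsRight b X · Y)
step-right-part {b = b} {X} adm@(tX , _) = step₁ [] (colsRight b X) adm IsTableau-[] tX̃ (sym ([]-· (colsRight b X) tX̃))
  where tX̃ = colsRight-IsTableau b X tX

step-top-rows : ∀ {T a b X Y} → Admissible T X Y → Step T a b (X , Y) (X · rowsBottom a Y , rowsTop a Y)
step-top-rows {T} {a} {b} {X} {Y} adm@(_ , tY , _) =
  subst (λ P → Step T a b (X , Y) (X · rowsBottom a Y , P)) ([]-· (take a Y) (take-IsTableau a Y tY))
        (step₂ (drop a Y) [] adm (drop-IsTableau a Y tY) IsTableau-[] refl)

admissible-bottom : ∀ a b T W → IsTableau W → CornerSmallest a b T W → Admissible T (rowsBottom a W) (P₀ a b W)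
admissible-bottom a b T W tW (sQ , sP , sZ) =
  drop-IsTableau a W tW , colsRight-IsTableau b (take a W) (take-IsTableau a W tW) ,
  All⇒AllSmaller T (drop a W) (All-cols⁻ b (drop a W) (AllSmaller⇒All T (Q₀ a b W) sQ) (AllSmaller⇒All T (Zpart a b W) sZ)) ,
  sP

colsLeft-0 : ∀ X → colsLeft 0 X ≡ []
colsLeft-0 [] = refl
colsLeft-0 (_ ∷ X) = colsLeft-0 X

colsRight-0 : ∀ X → All NonEmpty X → colsRight 0 X ≡ X
colsRight-0 [] _ = refl
colsRight-0 ((x ∷ xs) ∷ X) (_ ∷ nX) = cong ((x ∷ xs) ∷_) (colsRight-0 X nX)

reachable-width-0 : ∀ a T W Q P X Y → shape T ≡ rect a 0 → IsTableau W → SimpleFactorization a 0 T W Q P →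
                    IsTableau X → IsTableau Y → W ≡ X · T · Y → (X , Y) ⟶[ T , a , 0 ] (Q , P)
reachable-width-0 a [] W Q P X Y _ tW (_ , _ , _ , Q̃ , P̃ , tQ̃ , tP̃ , eZ , refl , refl) tX tY eW =
  subst (Step [] a 0 (X , Y)) (cong₂ _,_ (colsLeft-0 X) X·Y≡W) (step-right-part (tX , tY , none X , none Y))
  ∷ TransClosure.[ subst (Step [] a 0 ([] , W)) (cong₂ _,_ (cong (_· Q̃) (sym (colsLeft-0 (drop a W)))) (cong (P̃ ·_) (sym top)))
                         (step₂ Q̃ P̃ (IsTableau-[] , tW , none [] , none W) tQ̃ tP̃ (trans (sym bottom) eZ)) ]
  where
  none : ∀ U → AllSmaller [] U
  none U ()
  X·Y≡W : colsRight 0 X · Y ≡ W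
  X·Y≡W = trans (cong (_· Y) (colsRight-0 X (proj₁ tX))) (sym eW)
  top : colsRight 0 (take a W) ≡ take a W
  top = colsRight-0 (take a W) (AllP.take⁺ a (proj₁ tW))
  bottom : colsRight 0 (drop a W) ≡ drop a W
  bottom = colsRight-0 (drop a W) (AllP.drop⁺ a (proj₁ tW))

lemma4 : (a b : ℕ) (T W Q P X Y : Tab) →
    IsTableau T → shape T ≡ rect a b →
    IsTableau W → ContainsCorner a b T W → CornerSmallest a b T W →
    SimpleFactorization a b T W Q P →
    IsTableau X → IsTableau Y → W ≡ X · T · Y →
    (X , Y) ⟶[ T , a , b ] (Q , P)
lemma4 a zero T W Q P X Y _ shT tW _ _ sf tX tY eW = reachable-width-0 a T W Q P X Y shT tW sf tX tY eW
lemma4 a b@(suc b′) T _ _ _ X Y tT shT tW cc cs (_ , _ , _ , Q̃ , P̃ , tQ̃ , tP̃ , eZ , refl , refl) tX tY refl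
  with rect-rows T a b shT | factors-above a b T (X · T · Y) X Y cc cs refl
... | (width , height) | (sX , sY) =
  step-right-part (tX , tY , sX , sY)
  ∷ subst (Step T a b (colsLeft b X , colsRight b X · Y)) (cong₂ _,_ rowsBottom-corner (sym P₀-corner))
          (step-top-rows admissible-split)
  ∷ TransClosure.[ step₁ Q̃ P̃ (admissible-bottom a b T (X · T · Y) tW cs) tQ̃ tP̃ eZ ]
  where
  open Corner a b′ T tT width height
  open Factors X Y tX tY (AllSmaller⇒All T X sX) (AllSmaller⇒All T Y sY)
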